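{- For every integer $m\geq 0$, $$\sum_{\iota\in F\mathcal{I}_{2m}(132)} q^{\mathrm{coinv}(\iota)} \;=\; \sum_{\iota\in F\mathcal{I}_{2m}(213)} q^{\mathrm{coinv}(\iota)} \;=\; C_m(q^2),$$ where $C_0(q)=1$ and $C_n(q)=\sum_{k=0}^{n-1} q^k C_k(q)C_{n-k-1}(q)$ for $n\geq 1$.
   Context: Permutations of $[n]$ are written in one-line notation. A permutation $\sigma\in\mathfrak{S}_n$ contains a pattern $\pi\in\mathfrak{S}_k$ if there are indices $m_1<\dots<m_k$ such that $\sigma(m_1)\cdots\sigma(m_k)$ is in the same relative order as $\pi$; otherwise it avoids $\pi$. An involution is a permutation $\iota$ with $\iota^2=\mathrm{id}$; it is fixed-point-free if $\iota(i)\neq i$ for all $i$. $F\mathcal{I}_{n}(\pi)$ is the set of fixed-point-free involutions of $[n]$ avoiding $\pi$ ($F\mathcal{I}_0(\pi)$ consists of the empty permutation). A coinversion of $\sigma$ is a pair $i<j$ with $\sigma(i)<\sigma(j)$, and $\mathrm{coinv}(\sigma)$ is the number of coinversions. -}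

module Defs where

open import Data.Nat using (ℕ; zero; suc; _+_; _*_; _∸_; _<ᵇ_; _≡ᵇ_; _/_; _%_)
open import Data.Bool using (Bool; true; false; _∧_; _∨_; not; if_then_else_)
open import Data.Fin using (Fin; toℕ) renaming (zero to f0; suc to fs)
open import Data.List using (List; []; _∷_; map; concatMap; filter; length; allFin; upTo; foldr; lookup)
open import Data.Nat.ListAction using (sum)
open import Data.Vec using (Vec; []; _∷_) renaming (lookup to vlookup)
open import Relation.Nullary.Decidable using (yes; no)
open import Data.Bool.Properties using (T?)

-- Permutations in one-line notation: σ = (σ(0), …, σ(n-1)), values in Fin n
-- (0-based: the position i and value σ(i) stand for i+1 and σ(i)+1).

allWords : (n k : ℕ) → List (Vec (Fin k) n)
allWords zero    k = [] ∷ []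
allWords (suc n) k = concatMap (λ x → map (x ∷_) (allWords n k)) (allFin k)

allF : (n : ℕ) → (Fin n → Bool) → Bool
allF n p = foldr (λ i b → p i ∧ b) true (allFin n)

anyF : (n : ℕ) → (Fin n → Bool) → Bool
anyF n p = foldr (λ i b → p i ∨ b) false (allFin n)

_<F_ : {n : ℕ} → Fin n → Fin n → Bool
i <F j = toℕ i <ᵇ toℕ j

_==F_ : {n : ℕ} → Fin n → Fin n → Bool
i ==F j = toℕ i ≡ᵇ toℕ j

_⇔ᵇ_ : Bool → Bool → Bool
a ⇔ᵇ b = (a ∧ b) ∨ (not a ∧ not b)

isPerm : {n : ℕ} → Vec (Fin n) n → Bool
isPerm {n} σ = allF n λ i → allF n λ j → (vlookup σ i ==F vlookup σ j) ⇔ᵇ (i ==F j)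

isInvolution : {n : ℕ} → Vec (Fin n) n → Bool
isInvolution {n} σ = allF n λ i → vlookup σ (vlookup σ i) ==F i

isFixedPointFree : {n : ℕ} → Vec (Fin n) n → Bool
isFixedPointFree {n} σ = allF n λ i → not (vlookup σ i ==F i)

-- σ contains the pattern π ∈ S_k (π in one-line notation, 0-based values):
-- there are indices m_0 < … < m_{k-1} with σ(m_a) < σ(m_b) ⇔ π(a) < π(b).
contains : {n k : ℕ} → Vec (Fin n) n → Vec (Fin k) k → Bool
contains {n} {k} σ π = anyList (allWords k n)
  where
  ok : Vec (Fin n) k → Bool
  ok ms = allF k λ a → allF k λ b →
            ((a <F b) ⇔ᵇ (vlookup ms a <F vlookup ms b))
          ∧ ((vlookup σ (vlookup ms a) <F vlookup σ (vlookup ms b))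
               ⇔ᵇ (vlookup π a <F vlookup π b))
  anyList : List (Vec (Fin n) k) → Bool
  anyList = foldr (λ ms b → ok ms ∨ b) false

avoids : {n k : ℕ} → Vec (Fin n) n → Vec (Fin k) k → Bool
avoids σ π = not (contains σ π)

coinv : {n : ℕ} → Vec (Fin n) n → ℕ
coinv {n} σ = sum (map (λ i → sum (map (λ j →
                 if (i <F j) ∧ (vlookup σ i <F vlookup σ j) then 1 else 0)
                 (allFin n))) (allFin n))

FI : (n : ℕ) {k : ℕ} → Vec (Fin k) k → List (Vec (Fin n) n)
FI n π = filter (λ σ → T? (isPerm σ ∧ isInvolution σ ∧ isFixedPointFree σ ∧ avoids σ π))
                (allWords n n)

-- Polynomials in q with ℕ coefficients, represented by their coefficient
-- sequence ℕ → ℕ (finitely supported); p j = coefficient of q^j.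

Poly : Set
Poly = ℕ → ℕ

coinvGF : {n : ℕ} → List (Vec (Fin n) n) → Poly
coinvGF S j = length (filter (λ σ → T? (coinv σ ≡ᵇ j)) S)

Σ< : ℕ → (ℕ → ℕ) → ℕ
Σ< m f = sum (map f (upTo m))

_⊗_ : Poly → Poly → Poly
(f ⊗ g) j = Σ< (suc j) λ i → f i * g (j ∸ i)

shift : ℕ → Poly → Poly
shift k f j = if j <ᵇ k then 0 else f (j ∸ k)

substSq : Poly → Poly
substSq f j = if j % 2 ≡ᵇ 0 then f (j / 2) else 0

zeroP : Poly
zeroP _ = 0

oneP : Poly
oneP j = if j ≡ᵇ 0 then 1 else 0

nth : List Poly → ℕ → Poly
nth []       _       = zeroP
nth (p ∷ ps) zero    = p
nth (p ∷ ps) (suc i) = nth ps i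

catStep : ℕ → List Poly → Poly
catStep n cs j = Σ< (suc n) λ k → shift k (nth cs k ⊗ nth cs (n ∸ k)) j

catUpTo : ℕ → List Poly
catUpTo zero    = oneP ∷ []
catUpTo (suc n) = let cs = catUpTo n in cs Data.List.++ (catStep n cs ∷ [])

C : ℕ → Poly
C n = nth (catUpTo n) n

p132 : Vec (Fin 3) 3
p132 = f0 ∷ fs (fs f0) ∷ fs f0 ∷ []

p213 : Vec (Fin 3) 3
p213 = fs f0 ∷ f0 ∷ fs (fs f0) ∷ []

-- (A) Halving.  A 132-avoiding fixed-point-free involution ι of [2m] sends the
--     first half [0,m) onto the second half: a pair inside one half together
--     with a pair inside the other always produces a 132.  So ι is determined
--     by the permutation w(i) = ι(i) − m of [m], which avoids 132 exactly when ι
--     does, and coinv ι = 2·coinv w.  Hence the polynomial of FI_2m(132) is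
--     A_m(q²), where A_n is the coinversion polynomial of Av_n(132).
-- (B) Decomposition at the maximum.  In σ ∈ Av_{n+1}(132) with its maximum at
--     position k, every entry before the maximum exceeds every entry after it;
--     deleting the maximum is a bijection onto Av_k(132) × Av_{n-k}(132), and
--     coinv σ = k + coinv α + coinv β.  So A_n obeys the recurrence of C_n.
-- (C) Reverse-complement i ↦ N−1−ι(N−1−i) preserves involutions, fixed points
--     and coinversions, and exchanges the patterns 132 and 213.

module Submission where

open import Data.Bool using (Bool; true; false; _∧_; _∨_; not; if_then_else_; T)
open import Data.Bool.Properties using (T?; T-≡; ∧-comm; ∧-identityʳ; ∧-zeroʳ)
open import Data.Empty using (⊥-elim)
open import Data.Fin using (Fin; toℕ; fromℕ<) renaming (zero to f0; suc to fs)
open import Data.Fin.Properties using (toℕ-injective; toℕ-fromℕ<; toℕ<n; injective⇒≤)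
open import Data.List using (List; []; _∷_; map; filter; length; allFin; upTo; foldr; _++_; applyUpTo; cartesianProduct; cartesianProductWith; concatMap)
open import Data.List.Membership.Propositional using (_∈_)
open import Data.List.Membership.Propositional.Properties using (∈-map⁺; ∈-map⁻; ∈-upTo⁺; ∈-upTo⁻; ∈-allFin; ∈-filter⁺; ∈-filter⁻; ∈-cartesianProduct⁺; ∈-cartesianProduct⁻; ∈-cartesianProductWith⁺)
open import Data.List.Membership.Propositional.Properties.WithK using (unique∧set⇒bag)
open import Data.List.Properties using (map-∘; map-++; length-++; map-tabulate)
open import Data.List.Relation.Binary.BagAndSetEquality using (∼bag⇒↭)
open import Data.List.Relation.Binary.Permutation.Propositional using (_↭_)
import Data.List.Relation.Binary.Permutation.Propositional.Properties as Perm
import Data.List.Relation.Unary.All as All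
open import Data.List.Relation.Unary.Any using (here; there)
open import Data.List.Relation.Unary.Unique.Propositional using (Unique; []; _∷_)
open import Data.List.Relation.Unary.Unique.Propositional.Properties using (upTo⁺; allFin⁺; filter⁺; cartesianProduct⁺; cartesianProductWith⁺; Unique[x∷xs]⇒x∉xs)
open import Data.Nat using (ℕ; zero; suc; _+_; _*_; _∸_; _<ᵇ_; _≡ᵇ_; _≤ᵇ_; _≤_; _<_; s≤s; s≤s⁻¹; z<s; pred; _<?_; _≤?_; _≟_; _/_; _%_)
open import Data.Nat.DivMod using (m≡m%n+[m/n]*n; m*n%n≡0)
open import Data.Nat.ListAction using (sum)
open import Data.Nat.ListAction.Properties using (sum-++; sum-↭)
open import Data.Nat.Properties
open import Algebra.Properties.CommutativeSemigroup +-commutativeSemigroup using (interchange)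
open import Data.Product using (_×_; _,_; proj₁; proj₂; ∃-syntax)
open import Data.Sum using (_⊎_; inj₁; inj₂)
open import Data.Vec using (Vec; []; _∷_; tabulate) renaming (lookup to vlookup)
open import Data.Vec.Properties using (∷-injective; lookup∘tabulate)
open import Function using (_∘_; id)
open import Function.Bundles using (_⇔_; mk⇔; Equivalence)
open import Relation.Binary.Definitions using (tri<; tri≈; tri>)
open import Relation.Binary.PropositionalEquality using (_≡_; _≢_; refl; sym; trans; cong; cong₂; subst; subst₂; module ≡-Reasoning)
open import Relation.Nullary using (¬_; yes; no)
open import Relation.Nullary.Decidable using (dec-true; dec-false)

open import Defs

<ᵇ-true : ∀ {m n} → m < n → (m <ᵇ n) ≡ true
<ᵇ-true {m} {n} = dec-true (m <? n)

<ᵇ-false : ∀ {m n} → n ≤ m → (m <ᵇ n) ≡ false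
<ᵇ-false {m} {n} n≤m = dec-false (m <? n) (≤⇒≯ n≤m)

<ᵇ-true⁻ : ∀ {m n} → (m <ᵇ n) ≡ true → m < n
<ᵇ-true⁻ {m} {n} e = <ᵇ⇒< m n (Equivalence.from T-≡ e)

<ᵇ-false⁻ : ∀ {m n} → (m <ᵇ n) ≡ false → n ≤ m
<ᵇ-false⁻ e = ≮⇒≥ (λ m<n → subst T e (<⇒<ᵇ m<n))

≡ᵇ-true : ∀ {m n} → m ≡ n → (m ≡ᵇ n) ≡ true
≡ᵇ-true {m} {n} = dec-true (m ≟ n)

≡ᵇ-false : ∀ {m n} → m ≢ n → (m ≡ᵇ n) ≡ false
≡ᵇ-false {m} {n} = dec-false (m ≟ n)

≡ᵇ-true⁻ : ∀ {m n} → (m ≡ᵇ n) ≡ true → m ≡ n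
≡ᵇ-true⁻ {m} {n} e = ≡ᵇ⇒≡ m n (Equivalence.from T-≡ e)

≡ᵇ-false⁻ : ∀ {m n} → (m ≡ᵇ n) ≡ false → m ≢ n
≡ᵇ-false⁻ {m} {n} e m≡n = subst T e (≡⇒≡ᵇ m n m≡n)

≡ᵇ-iff : ∀ {a b c d} → (a ≡ b → c ≡ d) → (c ≡ d → a ≡ b) → (a ≡ᵇ b) ≡ (c ≡ᵇ d)
≡ᵇ-iff {a} {b} to from with a ≟ b
... | yes a≡b = trans (≡ᵇ-true a≡b) (sym (≡ᵇ-true (to a≡b)))
... | no a≢b  = trans (≡ᵇ-false a≢b) (sym (≡ᵇ-false (a≢b ∘ from)))

+-<ᵇ-cancelʳ : ∀ a b m → (a + m <ᵇ b + m) ≡ (a <ᵇ b)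
+-<ᵇ-cancelʳ a b m with a <? b
... | yes a<b = trans (<ᵇ-true (+-monoˡ-< m a<b)) (sym (<ᵇ-true a<b))
... | no a≮b  = trans (<ᵇ-false (+-monoˡ-≤ m (≮⇒≥ a≮b))) (sym (<ᵇ-false (≮⇒≥ a≮b)))

+-<ᵇ-cancelˡ : ∀ m a b → (m + a <ᵇ m + b) ≡ (a <ᵇ b)
+-<ᵇ-cancelˡ m a b = trans (cong₂ _<ᵇ_ (+-comm m a) (+-comm m b)) (+-<ᵇ-cancelʳ a b m)

∧-true⁻ˡ : ∀ {u v} → (u ∧ v) ≡ true → u ≡ true
∧-true⁻ˡ {true} _ = refl

∧-true⁻ʳ : ∀ {u v} → (u ∧ v) ≡ true → v ≡ true
∧-true⁻ʳ {true} e = e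

∧-true : ∀ {u v} → u ≡ true → v ≡ true → (u ∧ v) ≡ true
∧-true refl refl = refl

ind : Bool → ℕ
ind b = if b then 1 else 0

S : ℕ → (ℕ → ℕ) → ℕ
S zero    f = 0
S (suc m) f = f 0 + S m (f ∘ suc)

sum-map-applyUpTo : (f g : ℕ → ℕ) (m : ℕ) → sum (map f (applyUpTo g m)) ≡ S m (f ∘ g)
sum-map-applyUpTo f g zero    = refl
sum-map-applyUpTo f g (suc m) = cong (f (g 0) +_) (sum-map-applyUpTo f (g ∘ suc) m)

Σ<≡S : (m : ℕ) (f : ℕ → ℕ) → Σ< m f ≡ S m f
Σ<≡S m f = sum-map-applyUpTo f id m

S-cong : (m : ℕ) (f g : ℕ → ℕ) → (∀ i → i < m → f i ≡ g i) → S m f ≡ S m g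
S-cong zero    f g h = refl
S-cong (suc m) f g h =
  cong₂ _+_ (h 0 z<s) (S-cong m (f ∘ suc) (g ∘ suc) (λ i i< → h (suc i) (s≤s i<)))

S-const : (m c : ℕ) → S m (λ _ → c) ≡ m * c
S-const zero    c = refl
S-const (suc m) c = cong (c +_) (S-const m c)

S-zero : (m : ℕ) (f : ℕ → ℕ) → (∀ i → i < m → f i ≡ 0) → S m f ≡ 0
S-zero m f h = trans (S-cong m f (λ _ → 0) h) (trans (S-const m 0) (*-zeroʳ m))

S-+ : (m : ℕ) (f g : ℕ → ℕ) → S m (λ i → f i + g i) ≡ S m f + S m g
S-+ zero    f g = refl
S-+ (suc m) f g = trans (cong ((f 0 + g 0) +_) (S-+ m (f ∘ suc) (g ∘ suc)))
                        (interchange (f 0) (g 0) (S m (f ∘ suc)) (S m (g ∘ suc)))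

S-split : (a b : ℕ) (f : ℕ → ℕ) → S (a + b) f ≡ S a f + S b (λ i → f (a + i))
S-split zero    b f = refl
S-split (suc a) b f = trans (cong (f 0 +_) (S-split a b (f ∘ suc)))
                            (sym (+-assoc (f 0) (S a (f ∘ suc)) _))

S-swap : (a b : ℕ) (F : ℕ → ℕ → ℕ) →
  S a (λ i → S b (λ j → F i j)) ≡ S b (λ j → S a (λ i → F i j))
S-swap zero    b F = sym (S-zero b (λ _ → 0) (λ _ _ → refl))
S-swap (suc a) b F =
  trans (cong (S b (λ j → F 0 j) +_) (S-swap a b (λ i j → F (suc i) j)))
        (sym (S-+ b (λ j → F 0 j) (λ j → S a (λ i → F (suc i) j))))

S-single : (m x : ℕ) (f : ℕ → ℕ) → x < m → S m (λ i → ind (x ≡ᵇ i) * f i) ≡ f x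
S-single (suc m) zero    f _        =
  trans (cong ((f 0 + 0) +_) (S-zero m _ (λ _ _ → refl))) (trans (+-identityʳ _) (+-identityʳ (f 0)))
S-single (suc m) (suc x) f (s≤s x<) = S-single m x (f ∘ suc) x<

count : {A : Set} → (A → Bool) → List A → ℕ
count p xs = sum (map (ind ∘ p) xs)

length-filter : {A : Set} (p : A → Bool) (xs : List A) →
  length (filter (λ x → T? (p x)) xs) ≡ count p xs
length-filter p [] = refl
length-filter p (x ∷ xs) with p x
... | true  = cong suc (length-filter p xs)
... | false = length-filter p xs

count-map : {A B : Set} (p : B → Bool) (g : A → B) (xs : List A) →
  count p (map g xs) ≡ count (p ∘ g) xs
count-map p g xs = cong sum (sym (map-∘ xs))

count-++ : {A : Set} (p : A → Bool) (xs ys : List A) → count p (xs ++ ys) ≡ count p xs + count p ys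
count-++ p xs ys = trans (cong sum (map-++ (ind ∘ p) xs ys)) (sum-++ (map (ind ∘ p) xs) _)

count-↭ : {A : Set} (p : A → Bool) {xs ys : List A} → xs ↭ ys → count p xs ≡ count p ys
count-↭ p xs↭ys = sum-↭ (Perm.map⁺ (ind ∘ p) xs↭ys)

count-cong : {A : Set} (p q : A → Bool) (xs : List A) →
  (∀ {x} → x ∈ xs → p x ≡ q x) → count p xs ≡ count q xs
count-cong p q []       h = refl
count-cong p q (x ∷ xs) h =
  cong₂ _+_ (cong ind (h (here refl))) (count-cong p q xs (h ∘ there))

count-false : {A : Set} (p : A → Bool) (xs : List A) → (∀ {x} → x ∈ xs → p x ≡ false) → count p xs ≡ 0
count-false p []       h = refl
count-false p (x ∷ xs) h rewrite h (here refl) = count-false p xs (h ∘ there)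

count-filter : {A : Set} (p q : A → Bool) (xs : List A) →
  count (λ x → p x ∧ q x) xs ≡ count p (filter (λ x → T? (q x)) xs)
count-filter p q []       = refl
count-filter p q (x ∷ xs) with q x
... | true  rewrite ∧-identityʳ (p x) = cong (ind (p x) +_) (count-filter p q xs)
... | false rewrite ∧-zeroʳ (p x)     = count-filter p q xs

count-partition : {A : Set} (p : A → Bool) (key : A → ℕ) (N : ℕ) (xs : List A) →
  (∀ {x} → x ∈ xs → key x < N) →
  count p xs ≡ S N (λ k → count (λ x → p x ∧ (key x ≡ᵇ k)) xs)
count-partition p key N []       h = sym (S-zero N _ (λ _ _ → refl))
count-partition p key N (x ∷ xs) h =
  trans (cong₂ _+_ head (count-partition p key N xs (h ∘ there)))
        (sym (S-+ N (λ k → ind (p x ∧ (key x ≡ᵇ k))) (λ k → count (λ x → p x ∧ (key x ≡ᵇ k)) xs)))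
  where
  head : ind (p x) ≡ S N (λ k → ind (p x ∧ (key x ≡ᵇ k)))
  head with p x
  ... | true  = sym (trans (S-cong N _ _ (λ k _ → sym (*-identityʳ (ind (key x ≡ᵇ k)))))
                           (S-single N (key x) (λ _ → 1) (h (here refl))))
  ... | false = sym (S-zero N _ (λ _ _ → refl))

map-unique : {A B : Set} (f : A → B) {xs : List A} → Unique xs →
  (∀ {x y} → x ∈ xs → y ∈ xs → f x ≡ f y → x ≡ y) → Unique (map f xs)
map-unique f {[]}     _           inj = []
map-unique f {x ∷ xs} (x∉ ∷ uxs) inj =
  All.tabulate fresh ∷ map-unique f uxs (λ a b → inj (there a) (there b))
  where
  fresh : ∀ {y} → y ∈ map f xs → f x ≢ y
  fresh y∈ fx≡y with ∈-map⁻ f y∈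
  ... | z , z∈ , refl =
    Unique[x∷xs]⇒x∉xs (x∉ ∷ uxs) (subst (_∈ xs) (sym (inj (here refl) (there z∈) fx≡y)) z∈)

unique-↭ : {A : Set} {xs ys : List A} → Unique xs → Unique ys →
  (∀ {x} → x ∈ xs → x ∈ ys) → (∀ {x} → x ∈ ys → x ∈ xs) → xs ↭ ys
unique-↭ uxs uys to from = ∼bag⇒↭ (unique∧set⇒bag uxs uys (mk⇔ to from))

bijection-count : {A B : Set} (p : B → Bool) (g : A → B) {xs : List A} {ys : List B} →
  Unique xs → Unique ys →
  (∀ {x} → x ∈ xs → g x ∈ ys) →
  (∀ {y} → y ∈ ys → ∃[ x ] (x ∈ xs × g x ≡ y)) →
  (∀ {x x'} → x ∈ xs → x' ∈ xs → g x ≡ g x' → x ≡ x') →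
  count (p ∘ g) xs ≡ count p ys
bijection-count p g {xs} {ys} uxs uys into onto inj =
  trans (sym (count-map p g xs)) (count-↭ p (unique-↭ (map-unique g uxs inj) uys to from))
  where
  to : ∀ {y} → y ∈ map g xs → y ∈ ys
  to y∈ with ∈-map⁻ g y∈
  ... | x , x∈ , refl = into x∈
  from : ∀ {y} → y ∈ ys → y ∈ map g xs
  from y∈ with onto y∈
  ... | x , x∈ , refl = ∈-map⁺ g x∈

+-≡ᵇ-shift : ∀ x t y → x ≤ t → (x + y ≡ᵇ t) ≡ (y ≡ᵇ (t ∸ x))
+-≡ᵇ-shift x t y x≤t = ≡ᵇ-iff (λ x+y≡t → trans (sym (m+n∸m≡n x y)) (cong (_∸ x) x+y≡t))
                             (λ y≡t∸x → trans (cong (x +_) y≡t∸x) (m+[n∸m]≡n x≤t))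

+-≡ᵇ-large : ∀ x t y → t < x → (x + y ≡ᵇ t) ≡ false
+-≡ᵇ-large x t y t<x = ≡ᵇ-false (λ q → <⇒≱ t<x (subst (x ≤_) q (m≤m+n x y)))

count-shift : {A : Set} (X : A → ℕ) (L : List A) (k j : ℕ) →
  count (λ a → (k + X a) ≡ᵇ j) L ≡ (if j <ᵇ k then 0 else count (λ a → X a ≡ᵇ (j ∸ k)) L)
count-shift X L k j with j <ᵇ k in eq
... | true  = count-false _ L (λ {a} _ → +-≡ᵇ-large k j (X a) (<ᵇ-true⁻ eq))
... | false = count-cong _ _ L (λ {a} _ → +-≡ᵇ-shift k j (X a) (<ᵇ-false⁻ eq))

count-row : {B : Set} (c : ℕ) (v : B → ℕ) (Bs : List B) (t : ℕ) →
  count (λ b → (c + v b) ≡ᵇ t) Bs ≡ S (suc t) (λ i → ind (c ≡ᵇ i) * count (λ b → v b ≡ᵇ (t ∸ i)) Bs)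
count-row c v Bs t with c ≤? t
... | yes c≤t = trans (count-cong _ _ Bs (λ {b} _ → +-≡ᵇ-shift c t (v b) c≤t))
                      (sym (S-single (suc t) c (λ i → count (λ b → v b ≡ᵇ (t ∸ i)) Bs) (s≤s c≤t)))
... | no c≰t  = trans (count-false _ Bs (λ {b} _ → +-≡ᵇ-large c t (v b) (≰⇒> c≰t)))
      (sym (S-zero (suc t) _ (λ i i≤t → cong (λ z → ind z * count (λ b → v b ≡ᵇ (t ∸ i)) Bs)
        (≡ᵇ-false (λ c≡i → c≰t (subst (_≤ t) (sym c≡i) (s≤s⁻¹ i≤t)))))))

count-convolution : {A B : Set} (u : A → ℕ) (v : B → ℕ) (As : List A) (Bs : List B) (t : ℕ) →
  count (λ ab → (u (proj₁ ab) + v (proj₂ ab)) ≡ᵇ t) (cartesianProduct As Bs)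
  ≡ S (suc t) (λ i → count (λ a → u a ≡ᵇ i) As * count (λ b → v b ≡ᵇ (t ∸ i)) Bs)
count-convolution u v []       Bs t = sym (S-zero (suc t) _ (λ _ _ → refl))
count-convolution u v (a ∷ As) Bs t = begin
    count P (map (a ,_) Bs ++ cartesianProduct As Bs)
      ≡⟨ count-++ P (map (a ,_) Bs) _ ⟩
    count P (map (a ,_) Bs) + count P (cartesianProduct As Bs)
      ≡⟨ cong₂ _+_ (trans (count-map P (a ,_) Bs) (count-row (u a) v Bs t)) (count-convolution u v As Bs t) ⟩
    S (suc t) (λ i → ind (u a ≡ᵇ i) * G i) + S (suc t) (λ i → count (λ a → u a ≡ᵇ i) As * G i)
      ≡⟨ S-+ (suc t) (λ i → ind (u a ≡ᵇ i) * G i) (λ i → count (λ a → u a ≡ᵇ i) As * G i) ⟨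
    S (suc t) (λ i → ind (u a ≡ᵇ i) * G i + count (λ a → u a ≡ᵇ i) As * G i)
      ≡⟨ S-cong (suc t) _ _ (λ i _ → sym (*-distribʳ-+ (G i) (ind (u a ≡ᵇ i)) (count (λ a → u a ≡ᵇ i) As))) ⟩
    S (suc t) (λ i → count (λ a → u a ≡ᵇ i) (a ∷ As) * G i) ∎
  where
  open ≡-Reasoning
  P : _ → Bool
  P ab = (u (proj₁ ab) + v (proj₂ ab)) ≡ᵇ t
  G : ℕ → ℕ
  G i = count (λ b → v b ≡ᵇ (t ∸ i)) Bs

Inj : ℕ → (ℕ → ℕ) → Set
Inj a g = ∀ {i j} → i < a → j < a → g i ≡ g j → i ≡ j

Into : ℕ → ℕ → (ℕ → ℕ) → Set
Into a b g = ∀ {i} → i < a → g i < b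

injection-≤ : (a b : ℕ) (g : ℕ → ℕ) → Inj a g → Into a b g → a ≤ b
injection-≤ a b g inj into = injective⇒≤ {f = gᶠ} gᶠ-inj
  where
  gᶠ : Fin a → Fin b
  gᶠ i = fromℕ< (into (toℕ<n i))
  gᶠ-inj : ∀ {i j} → gᶠ i ≡ gᶠ j → i ≡ j
  gᶠ-inj {i} {j} e = toℕ-injective (inj (toℕ<n i) (toℕ<n j)
    (trans (sym (toℕ-fromℕ< _)) (trans (cong toℕ e) (toℕ-fromℕ< _))))

-- An injection [a] → [b] missing some value v < b forces a < b
-- (extend it by a ↦ v and apply the pigeonhole principle).
injection-< : (a b v : ℕ) (g : ℕ → ℕ) → Inj a g → Into a b g → v < b →
  (∀ {i} → i < a → g i ≢ v) → a < b
injection-< a b v g inj into v<b miss = injection-≤ (suc a) b g⁺ inj⁺ into⁺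
  where
  g⁺ : ℕ → ℕ
  g⁺ i = if i <ᵇ a then g i else v
  g⁺-old : ∀ {i} → i < a → g⁺ i ≡ g i
  g⁺-old i<a rewrite <ᵇ-true i<a = refl
  g⁺-new : g⁺ a ≡ v
  g⁺-new rewrite <ᵇ-false (≤-refl {a}) = refl
  inj⁺ : Inj (suc a) g⁺
  inj⁺ i< j< e with m<1+n⇒m<n∨m≡n i< | m<1+n⇒m<n∨m≡n j<
  ... | inj₁ i<a  | inj₁ j<a  = inj i<a j<a (trans (sym (g⁺-old i<a)) (trans e (g⁺-old j<a)))
  ... | inj₁ i<a  | inj₂ refl = ⊥-elim (miss i<a (trans (sym (g⁺-old i<a)) (trans e g⁺-new)))
  ... | inj₂ refl | inj₁ j<a  = ⊥-elim (miss j<a (trans (sym (g⁺-old j<a)) (trans (sym e) g⁺-new)))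
  ... | inj₂ refl | inj₂ refl = refl
  into⁺ : Into (suc a) b g⁺
  into⁺ i< with m<1+n⇒m<n∨m≡n i<
  ... | inj₁ i<a  = subst (_< b) (sym (g⁺-old i<a)) (into i<a)
  ... | inj₂ refl = subst (_< b) (sym g⁺-new) v<b

search : (m : ℕ) (p : ℕ → Bool) → (∃[ i ] (i < m × p i ≡ true)) ⊎ (∀ i → i < m → p i ≡ false)
search zero    p = inj₂ (λ i ())
search (suc m) p with p 0 in p0
... | true  = inj₁ (0 , z<s , p0)
... | false with search m (p ∘ suc)
... | inj₁ (i , i< , pi) = inj₁ (suc i , s≤s i< , pi)
... | inj₂ none = inj₂ λ { zero _ → p0 ; (suc i) (s≤s i<) → none i i< }

surjective : (a : ℕ) (g : ℕ → ℕ) → Inj a g → Into a a g → ∀ {x} → x < a → ∃[ i ] (i < a × g i ≡ x)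
surjective a g inj into {x} x<a with search a (λ i → g i ≡ᵇ x)
... | inj₁ (i , i<a , e) = i , i<a , ≡ᵇ-true⁻ e
... | inj₂ none = ⊥-elim (<-irrefl refl
        (injection-< a a x g inj into x<a (λ {i} i<a → ≡ᵇ-false⁻ (none i i<a))))

-- The least i < m with p i (and m if there is none).
find : ℕ → (ℕ → Bool) → ℕ
find zero    p = 0
find (suc m) p = if p 0 then 0 else suc (find m (p ∘ suc))

find-spec : (m : ℕ) (p : ℕ → Bool) (i : ℕ) → i < m → p i ≡ true →
  find m p < m × p (find m p) ≡ true
find-spec (suc m) p i i<m pi with p 0 in p0
... | true = z<s , p0
find-spec (suc m) p zero    _        pi | false with () ← trans (sym p0) pi
find-spec (suc m) p (suc i) (s≤s i<) pi | false with find-spec m (p ∘ suc) i i< pi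
... | found< , found = s≤s found< , found

find-cong : (m : ℕ) (p q : ℕ → Bool) → (∀ {i} → i < m → p i ≡ q i) → find m p ≡ find m q
find-cong zero    p q h = refl
find-cong (suc m) p q h rewrite h {0} z<s =
  cong (λ z → if q 0 then 0 else suc z) (find-cong m (p ∘ suc) (q ∘ suc) (h ∘ s≤s))

inverse : ℕ → (ℕ → ℕ) → ℕ → ℕ
inverse a g x = find a (λ i → g i ≡ᵇ x)

module _ {a : ℕ} {g : ℕ → ℕ} (inj : Inj a g) (into : Into a a g) where

  inverse-into : Into a a (inverse a g)
  inverse-into x<a with surjective a g inj into x<a
  ... | i , i<a , gi≡x = proj₁ (find-spec a _ i i<a (≡ᵇ-true gi≡x))

  inverse-right : ∀ {x} → x < a → g (inverse a g x) ≡ x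
  inverse-right x<a with surjective a g inj into x<a
  ... | i , i<a , gi≡x = ≡ᵇ-true⁻ (proj₂ (find-spec a _ i i<a (≡ᵇ-true gi≡x)))

  inverse-left : ∀ {i} → i < a → inverse a g (g i) ≡ i
  inverse-left i<a = inj (inverse-into (into i<a)) i<a (inverse-right (into i<a))

  S-reindex : (f : ℕ → ℕ) → S a f ≡ S a (f ∘ g)
  S-reindex f = begin
      S a f                        ≡⟨ sum-map-applyUpTo f id a ⟨
      sum (map f (upTo a))         ≡⟨ sum-↭ (Perm.map⁺ f g[a]↭[a]) ⟨
      sum (map f (map g (upTo a))) ≡⟨ cong sum (map-∘ (upTo a)) ⟨
      sum (map (f ∘ g) (upTo a))   ≡⟨ sum-map-applyUpTo (f ∘ g) id a ⟩
      S a (f ∘ g)                  ∎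
    where
    open ≡-Reasoning
    g[a]↭[a] : map g (upTo a) ↭ upTo a
    g[a]↭[a] = unique-↭ (map-unique g (upTo⁺ a) (λ i∈ j∈ → inj (∈-upTo⁻ i∈) (∈-upTo⁻ j∈))) (upTo⁺ a) to from
      where
      to : ∀ {x} → x ∈ map g (upTo a) → x ∈ upTo a
      to x∈ with ∈-map⁻ g x∈
      ... | i , i∈ , refl = ∈-upTo⁺ (into (∈-upTo⁻ i∈))
      from : ∀ {x} → x ∈ upTo a → x ∈ map g (upTo a)
      from x∈ with surjective a g inj into (∈-upTo⁻ x∈)
      ... | i , i<a , refl = ∈-map⁺ g (∈-upTo⁺ i<a)

-- A word σ ∈ (Fin n)^k read as the map i ↦ σ(i) (and 0 beyond the end).
at : ∀ {n k} → Vec (Fin n) k → ℕ → ℕ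
at []       i       = 0
at (x ∷ xs) zero    = toℕ x
at (x ∷ xs) (suc i) = at xs i

at-lookup : ∀ {n k} (σ : Vec (Fin n) k) (i : Fin k) → at σ (toℕ i) ≡ toℕ (vlookup σ i)
at-lookup (x ∷ σ) f0     = refl
at-lookup (x ∷ σ) (fs i) = at-lookup σ i

at-fromℕ< : ∀ {n k i} (σ : Vec (Fin n) k) (i<k : i < k) → toℕ (vlookup σ (fromℕ< i<k)) ≡ at σ i
at-fromℕ< σ i<k = trans (sym (at-lookup σ _)) (cong (at σ) (toℕ-fromℕ< i<k))

at-into : ∀ {n k} (σ : Vec (Fin n) k) → Into k n (at σ)
at-into (x ∷ σ) {zero}  _        = toℕ<n x
at-into (x ∷ σ) {suc i} (s≤s i<) = at-into σ i<

Agree : ℕ → (ℕ → ℕ) → (ℕ → ℕ) → Set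
Agree N f g = ∀ {i} → i < N → f i ≡ g i

Agree-sym : ∀ {N f g} → Agree N f g → Agree N g f
Agree-sym e i< = sym (e i<)

at-injective : ∀ {n k} (σ τ : Vec (Fin n) k) → Agree k (at σ) (at τ) → σ ≡ τ
at-injective []      []      _ = refl
at-injective (x ∷ σ) (y ∷ τ) e =
  cong₂ _∷_ (toℕ-injective (e z<s)) (at-injective σ τ (e ∘ s≤s))

toFin : ∀ {n} → ℕ → Fin n → Fin n
toFin {n} v d with v <? n
... | yes v<n = fromℕ< v<n
... | no _    = d

toFin-ok : ∀ {n v} (d : Fin n) → v < n → toℕ (toFin v d) ≡ v
toFin-ok {n} {v} d v<n with v <? n
... | yes v<n′ = toℕ-fromℕ< v<n′
... | no v≮n   = ⊥-elim (v≮n v<n)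

build : (n : ℕ) → (ℕ → ℕ) → Vec (Fin n) n
build n f = tabulate (λ i → toFin (f (toℕ i)) i)

at-build : (n : ℕ) (f : ℕ → ℕ) → Into n n f → Agree n (at (build n f)) f
at-build n f into {i} i<n = begin
    at (build n f) i              ≡⟨ at-fromℕ< (build n f) i<n ⟨
    toℕ (vlookup (build n f) I)   ≡⟨ cong toℕ (lookup∘tabulate _ I) ⟩
    toℕ (toFin (f (toℕ I)) I)     ≡⟨ toFin-ok I (into (subst (_< n) (sym (toℕ-fromℕ< i<n)) i<n)) ⟩
    f (toℕ I)                     ≡⟨ cong f (toℕ-fromℕ< i<n) ⟩
    f i                           ∎
  where
  open ≡-Reasoning
  I = fromℕ< i<n

Invol : ℕ → (ℕ → ℕ) → Set
Invol n f = ∀ {i} → i < n → f (f i) ≡ i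

FixedPointFree : ℕ → (ℕ → ℕ) → Set
FixedPointFree n f = ∀ {i} → i < n → f i ≢ i

Has132 : ℕ → (ℕ → ℕ) → Set
Has132 n f = ∃[ i ] ∃[ j ] ∃[ k ] (i < j × j < k × k < n × f i < f k × f k < f j)

Has213 : ℕ → (ℕ → ℕ) → Set
Has213 n f = ∃[ i ] ∃[ j ] ∃[ k ] (i < j × j < k × k < n × f j < f i × f i < f k)

coinvPair : (ℕ → ℕ) → ℕ → ℕ → ℕ
coinvPair f i j = ind ((i <ᵇ j) ∧ (f i <ᵇ f j))

coinvOn : ℕ → (ℕ → ℕ) → ℕ
coinvOn n f = S n (λ i → S n (λ j → coinvPair f i j))

coinvPair-eval : ∀ f i j {b₁ b₂} → (i <ᵇ j) ≡ b₁ → (f i <ᵇ f j) ≡ b₂ → coinvPair f i j ≡ ind (b₁ ∧ b₂)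
coinvPair-eval f i j refl refl = refl

coinvPair-desc : ∀ f i j → f j ≤ f i → coinvPair f i j ≡ 0
coinvPair-desc f i j fj≤fi rewrite <ᵇ-false fj≤fi | ∧-zeroʳ (i <ᵇ j) = refl

coinvPair-back : ∀ f i j → j ≤ i → coinvPair f i j ≡ 0
coinvPair-back f i j j≤i rewrite <ᵇ-false j≤i = refl

module _ {N : ℕ} {f g : ℕ → ℕ} (f≗g : Agree N f g) where

  Inj-agree : Inj N f → Inj N g
  Inj-agree inj i< j< e = inj i< j< (trans (f≗g i<) (trans e (sym (f≗g j<))))

  Invol-agree : Into N N f → Invol N f → Invol N g
  Invol-agree into invol {i} i< =
    trans (sym (f≗g (subst (_< N) (f≗g i<) (into i<)))) (trans (cong f (sym (f≗g i<))) (invol i<))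

  FixedPointFree-agree : FixedPointFree N f → FixedPointFree N g
  FixedPointFree-agree fpf i< e = fpf i< (trans (f≗g i<) e)

  Has132-agree : Has132 N g → Has132 N f
  Has132-agree (i , j , k , i<j , j<k , k<N , a , b) = i , j , k , i<j , j<k , k<N ,
      subst₂ _<_ (sym (f≗g i<N)) (sym (f≗g k<N)) a , subst₂ _<_ (sym (f≗g k<N)) (sym (f≗g j<N)) b
    where j<N = <-trans j<k k<N
          i<N = <-trans i<j j<N

  Has213-agree : Has213 N g → Has213 N f
  Has213-agree (i , j , k , i<j , j<k , k<N , a , b) = i , j , k , i<j , j<k , k<N ,
      subst₂ _<_ (sym (f≗g j<N)) (sym (f≗g i<N)) a , subst₂ _<_ (sym (f≗g i<N)) (sym (f≗g k<N)) b
    where j<N = <-trans j<k k<N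
          i<N = <-trans i<j j<N

  coinvOn-agree : coinvOn N f ≡ coinvOn N g
  coinvOn-agree = S-cong N _ _ (λ i i< → S-cong N _ _ (λ j j< →
    cong₂ (λ u v → ind ((i <ᵇ j) ∧ (u <ᵇ v))) (f≗g i<) (f≗g j<)))

⇔ᵇ-true⁻ : ∀ {u v} → (u ⇔ᵇ v) ≡ true → u ≡ v
⇔ᵇ-true⁻ {true}  {true}  _ = refl
⇔ᵇ-true⁻ {false} {false} _ = refl

⇔ᵇ-true : ∀ {u v} → u ≡ v → (u ⇔ᵇ v) ≡ true
⇔ᵇ-true {true}  refl = refl
⇔ᵇ-true {false} refl = refl

allF-spec : (n : ℕ) (p : Fin n → Bool) → allF n p ≡ true ⇔ (∀ i → p i ≡ true)
allF-spec n p = mk⇔ (λ e i → all⁻ (allFin n) e (∈-allFin i)) (λ h → all⁺ (allFin n) (λ {x} _ → h x))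
  where
  all⁻ : ∀ xs → foldr (λ i b → p i ∧ b) true xs ≡ true → ∀ {x} → x ∈ xs → p x ≡ true
  all⁻ (y ∷ xs) e (here refl) = ∧-true⁻ˡ e
  all⁻ (y ∷ xs) e (there x∈)  = all⁻ xs (∧-true⁻ʳ {p y} e) x∈
  all⁺ : ∀ xs → (∀ {x} → x ∈ xs → p x ≡ true) → foldr (λ i b → p i ∧ b) true xs ≡ true
  all⁺ []       h = refl
  all⁺ (y ∷ xs) h = ∧-true (h (here refl)) (all⁺ xs (h ∘ there))

any-spec : {A : Set} (p : A → Bool) (xs : List A) →
  foldr (λ x b → p x ∨ b) false xs ≡ true ⇔ (∃[ x ] (x ∈ xs × p x ≡ true))
any-spec p xs = mk⇔ (any⁻ xs) (λ (x , x∈ , px) → any⁺ xs x∈ px)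
  where
  any⁻ : ∀ xs → foldr (λ x b → p x ∨ b) false xs ≡ true → ∃[ x ] (x ∈ xs × p x ≡ true)
  any⁻ (y ∷ xs) e with p y in py
  ... | true  = y , here refl , py
  ... | false with any⁻ xs e
  ... | x , x∈ , px = x , there x∈ , px
  any⁺ : ∀ xs {x} → x ∈ xs → p x ≡ true → foldr (λ x b → p x ∨ b) false xs ≡ true
  any⁺ (y ∷ xs) (here refl) px rewrite px = refl
  any⁺ (y ∷ xs) (there x∈)  px with p y
  ... | true  = refl
  ... | false = any⁺ xs x∈ px

allWords-suc : (n k : ℕ) → allWords (suc n) k ≡ cartesianProductWith _∷_ (allFin k) (allWords n k)
allWords-suc n k = go (allFin k)
  where
  go : ∀ xs → concatMap (λ x → map (x ∷_) (allWords n k)) xs ≡ cartesianProductWith _∷_ xs (allWords n k)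
  go []       = refl
  go (x ∷ xs) = cong (map (x ∷_) (allWords n k) ++_) (go xs)

allWords-complete : (n k : ℕ) (v : Vec (Fin k) n) → v ∈ allWords n k
allWords-complete zero    k []      = here refl
allWords-complete (suc n) k (x ∷ v) = subst ((x ∷ v) ∈_) (sym (allWords-suc n k))
  (∈-cartesianProductWith⁺ _∷_ (∈-allFin x) (allWords-complete n k v))

allWords-unique : (n k : ℕ) → Unique (allWords n k)
allWords-unique zero    k = All.[] ∷ []
allWords-unique (suc n) k = subst Unique (sym (allWords-suc n k))
  (cartesianProductWith⁺ _∷_ ∷-injective (allFin⁺ k) (allWords-unique n k))

coinv-at : ∀ {n} (σ : Vec (Fin n) n) → coinv σ ≡ coinvOn n (at σ)
coinv-at {n} σ = sum-allFin n _ _ (λ i → sum-allFin n _ _ (λ j →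
    cong₂ (λ a b → ind ((toℕ i <ᵇ toℕ j) ∧ (a <ᵇ b))) (sym (at-lookup σ i)) (sym (at-lookup σ j))))
  where
  sum-allFin : (n : ℕ) (g : Fin n → ℕ) (G : ℕ → ℕ) → (∀ i → g i ≡ G (toℕ i)) →
    sum (map g (allFin n)) ≡ S n G
  sum-allFin n g G h = trans (cong sum (map-tabulate id g)) (go n g G h)
    where
    go : (n : ℕ) (g : Fin n → ℕ) (G : ℕ → ℕ) → (∀ i → g i ≡ G (toℕ i)) → sum (Data.List.tabulate g) ≡ S n G
    go zero    g G h = refl
    go (suc n) g G h = cong₂ _+_ (h f0) (go n (g ∘ fs) (G ∘ suc) (h ∘ fs))

module _ {n : ℕ} (σ : Vec (Fin n) n) where

  isPerm-spec : isPerm σ ≡ true ⇔ Inj n (at σ)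
  isPerm-spec = mk⇔ to from
    where
    to : isPerm σ ≡ true → Inj n (at σ)
    to e {i} {j} i<n j<n σi≡σj = begin
        i                ≡⟨ toℕ-fromℕ< i<n ⟨
        toℕ (fromℕ< i<n) ≡⟨ ≡ᵇ-true⁻ (trans (sym same) (≡ᵇ-true values)) ⟩
        toℕ (fromℕ< j<n) ≡⟨ toℕ-fromℕ< j<n ⟩
        j                ∎
      where
      open ≡-Reasoning
      same : (toℕ (vlookup σ (fromℕ< i<n)) ≡ᵇ toℕ (vlookup σ (fromℕ< j<n))) ≡ (toℕ (fromℕ< i<n) ≡ᵇ toℕ (fromℕ< j<n))
      same = ⇔ᵇ-true⁻ (Equivalence.to (allF-spec n _) (Equivalence.to (allF-spec n _) e (fromℕ< i<n)) (fromℕ< j<n))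
      values : toℕ (vlookup σ (fromℕ< i<n)) ≡ toℕ (vlookup σ (fromℕ< j<n))
      values = trans (at-fromℕ< σ i<n) (trans σi≡σj (sym (at-fromℕ< σ j<n)))
    from : Inj n (at σ) → isPerm σ ≡ true
    from inj = Equivalence.from (allF-spec n _) λ i → Equivalence.from (allF-spec n _) λ j → ⇔ᵇ-true (same i j)
      where
      same : ∀ i j → (toℕ (vlookup σ i) ≡ᵇ toℕ (vlookup σ j)) ≡ (toℕ i ≡ᵇ toℕ j)
      same i j with toℕ i ≟ toℕ j
      ... | yes i≡j = trans (≡ᵇ-true (cong (λ z → toℕ (vlookup σ z)) (toℕ-injective i≡j))) (sym (≡ᵇ-true i≡j))
      ... | no i≢j  = trans (≡ᵇ-false (λ e → i≢j (inj (toℕ<n i) (toℕ<n j)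
                        (trans (at-lookup σ i) (trans e (sym (at-lookup σ j))))))) (sym (≡ᵇ-false i≢j))

  isInvolution-spec : isInvolution σ ≡ true ⇔ Invol n (at σ)
  isInvolution-spec = mk⇔ to from
    where
    to : isInvolution σ ≡ true → Invol n (at σ)
    to e {i} i<n = begin
        at σ (at σ i)                            ≡⟨ cong (at σ) (at-fromℕ< σ i<n) ⟨
        at σ (toℕ (vlookup σ (fromℕ< i<n)))      ≡⟨ at-lookup σ _ ⟩
        toℕ (vlookup σ (vlookup σ (fromℕ< i<n))) ≡⟨ ≡ᵇ-true⁻ (Equivalence.to (allF-spec n _) e (fromℕ< i<n)) ⟩
        toℕ (fromℕ< i<n)                         ≡⟨ toℕ-fromℕ< i<n ⟩
        i                                        ∎
      where open ≡-Reasoning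
    from : Invol n (at σ) → isInvolution σ ≡ true
    from invol = Equivalence.from (allF-spec n _) λ i → ≡ᵇ-true
      (trans (sym (at-lookup σ _)) (trans (cong (at σ) (sym (at-lookup σ i))) (invol (toℕ<n i))))

  isFixedPointFree-spec : isFixedPointFree σ ≡ true ⇔ FixedPointFree n (at σ)
  isFixedPointFree-spec = mk⇔ to from
    where
    to : isFixedPointFree σ ≡ true → FixedPointFree n (at σ)
    to e {i} i<n σi≡i = subst T (not-true⁻ (Equivalence.to (allF-spec n _) e (fromℕ< i<n)))
      (≡⇒≡ᵇ _ _ (trans (at-fromℕ< σ i<n) (trans σi≡i (sym (toℕ-fromℕ< i<n)))))
      where
      not-true⁻ : ∀ {u} → not u ≡ true → u ≡ false
      not-true⁻ {false} _ = refl
    from : FixedPointFree n (at σ) → isFixedPointFree σ ≡ true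
    from fpf = Equivalence.from (allF-spec n _) λ i →
      cong not (≡ᵇ-false (λ e → fpf (toℕ<n i) (trans (at-lookup σ i) e)))

-- The test that `contains` applies to a vector ms of candidate positions
-- (the local definition `ok` of Defs.contains, repeated verbatim).
occurrence? : {n k : ℕ} → Vec (Fin n) n → Vec (Fin k) k → Vec (Fin n) k → Bool
occurrence? {k = k} σ π ms = allF k λ a → allF k λ b →
    ((a <F b) ⇔ᵇ (vlookup ms a <F vlookup ms b))
  ∧ ((vlookup σ (vlookup ms a) <F vlookup σ (vlookup ms b)) ⇔ᵇ (vlookup π a <F vlookup π b))

triple : ℕ → ℕ → ℕ → Fin 3 → ℕ
triple a b c f0           = a
triple a b c (fs f0)      = b
triple a b c (fs (fs f0)) = c

SameOrder : Vec (Fin 3) 3 → ℕ → ℕ → ℕ → Set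
SameOrder π A B C = ∀ p q → (triple A B C p <ᵇ triple A B C q) ≡ (vlookup π p <F vlookup π q)

SameOrder-resp : ∀ π {A B C A′ B′ C′} → A ≡ A′ → B ≡ B′ → C ≡ C′ → SameOrder π A B C → SameOrder π A′ B′ C′
SameOrder-resp π refl refl refl same = same

Occurs : Vec (Fin 3) 3 → ℕ → (ℕ → ℕ) → Set
Occurs π n f = ∃[ a ] ∃[ b ] ∃[ c ] (a < b × b < c × c < n × SameOrder π (f a) (f b) (f c))

-- On a triple of positions, occurrence? computes to the following test.
tripleTest : Vec (Fin 3) 3 → (a b c A B C : ℕ) → Bool
tripleTest π a b c A B C = allF 3 λ p → allF 3 λ q →
    ((p <F q) ⇔ᵇ (triple a b c p <ᵇ triple a b c q))
  ∧ ((triple A B C p <ᵇ triple A B C q) ⇔ᵇ (vlookup π p <F vlookup π q))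

increasing-order : ∀ {a b c} → a < b → b < c → ∀ p q → (toℕ p <ᵇ toℕ q) ≡ (triple a b c p <ᵇ triple a b c q)
increasing-order {a} {b} {c} a<b b<c = table
  where
  table : ∀ p q → (toℕ p <ᵇ toℕ q) ≡ (triple a b c p <ᵇ triple a b c q)
  table f0           f0           = sym (<ᵇ-false (≤-refl {a}))
  table f0           (fs f0)      = sym (<ᵇ-true a<b)
  table f0           (fs (fs f0)) = sym (<ᵇ-true (<-trans a<b b<c))
  table (fs f0)      f0           = sym (<ᵇ-false (<⇒≤ a<b))
  table (fs f0)      (fs f0)      = sym (<ᵇ-false (≤-refl {b}))
  table (fs f0)      (fs (fs f0)) = sym (<ᵇ-true b<c)
  table (fs (fs f0)) f0           = sym (<ᵇ-false (<⇒≤ (<-trans a<b b<c)))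
  table (fs (fs f0)) (fs f0)      = sym (<ᵇ-false (<⇒≤ b<c))
  table (fs (fs f0)) (fs (fs f0)) = sym (<ᵇ-false (≤-refl {c}))

tripleTest-spec : ∀ π {a b c A B C} → tripleTest π a b c A B C ≡ true ⇔ (a < b × b < c × SameOrder π A B C)
tripleTest-spec π {a} {b} {c} {A} {B} {C} = mk⇔ to from
  where
  cell : Fin 3 → Fin 3 → Bool
  cell p q = ((p <F q) ⇔ᵇ (triple a b c p <ᵇ triple a b c q))
           ∧ ((triple A B C p <ᵇ triple A B C q) ⇔ᵇ (vlookup π p <F vlookup π q))
  cells : tripleTest π a b c A B C ≡ true → ∀ p q → cell p q ≡ true
  cells e p = Equivalence.to (allF-spec 3 (cell p)) (Equivalence.to (allF-spec 3 (λ p → allF 3 (cell p))) e p)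
  to : tripleTest π a b c A B C ≡ true → a < b × b < c × SameOrder π A B C
  to e = <ᵇ-true⁻ (sym (⇔ᵇ-true⁻ (∧-true⁻ˡ (cells e f0 (fs f0)))))
       , <ᵇ-true⁻ (sym (⇔ᵇ-true⁻ (∧-true⁻ˡ (cells e (fs f0) (fs (fs f0))))))
       , λ p q → ⇔ᵇ-true⁻ (∧-true⁻ʳ {(p <F q) ⇔ᵇ _} (cells e p q))
  from : a < b × b < c × SameOrder π A B C → tripleTest π a b c A B C ≡ true
  from (a<b , b<c , same) =
    Equivalence.from (allF-spec 3 (λ p → allF 3 (cell p))) λ p →
    Equivalence.from (allF-spec 3 (cell p)) λ q →
    ∧-true (⇔ᵇ-true (increasing-order a<b b<c p q)) (⇔ᵇ-true (same p q))

contains-spec : ∀ {n} (σ : Vec (Fin n) n) (π : Vec (Fin 3) 3) → contains σ π ≡ true ⇔ Occurs π n (at σ)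
contains-spec {n} σ π = mk⇔ to from
  where
  to : contains σ π ≡ true → Occurs π n (at σ)
  to e with Equivalence.to (any-spec (occurrence? σ π) (allWords 3 n)) e
  ... | x ∷ y ∷ z ∷ [] , _ , test with Equivalence.to (tripleTest-spec π) test
  ... | x<y , y<z , same = toℕ x , toℕ y , toℕ z , x<y , y<z , toℕ<n z ,
        SameOrder-resp π (sym (at-lookup σ x)) (sym (at-lookup σ y)) (sym (at-lookup σ z)) same
  from : Occurs π n (at σ) → contains σ π ≡ true
  from (a , b , c , a<b , b<c , c<n , same) =
    Equivalence.from (any-spec (occurrence? σ π) (allWords 3 n))
      (x ∷ y ∷ z ∷ [] , allWords-complete 3 n _ , Equivalence.from (tripleTest-spec π)
        ( subst₂ _<_ (sym (toℕ-fromℕ< a<n)) (sym (toℕ-fromℕ< b<n)) a<b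
        , subst₂ _<_ (sym (toℕ-fromℕ< b<n)) (sym (toℕ-fromℕ< c<n)) b<c
        , SameOrder-resp π (sym (at-fromℕ< σ a<n)) (sym (at-fromℕ< σ b<n)) (sym (at-fromℕ< σ c<n)) same))
    where
    b<n = <-trans b<c c<n
    a<n = <-trans a<b b<n
    x = fromℕ< a<n
    y = fromℕ< b<n
    z = fromℕ< c<n

Has132⇔Occurs : ∀ {n f} → Has132 n f ⇔ Occurs p132 n f
Has132⇔Occurs = mk⇔
  (λ (i , j , k , i<j , j<k , k<n , A<C , C<B) → i , j , k , i<j , j<k , k<n , table A<C C<B)
  (λ (i , j , k , i<j , j<k , k<n , same) →
     i , j , k , i<j , j<k , k<n , <ᵇ-true⁻ (same f0 (fs (fs f0))) , <ᵇ-true⁻ (same (fs (fs f0)) (fs f0)))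
  where
  table : ∀ {A B C} → A < C → C < B → SameOrder p132 A B C
  table {A} {B} {C} A<C C<B = λ where
    f0           f0           → <ᵇ-false (≤-refl {A})
    f0           (fs f0)      → <ᵇ-true (<-trans A<C C<B)
    f0           (fs (fs f0)) → <ᵇ-true A<C
    (fs f0)      f0           → <ᵇ-false (<⇒≤ (<-trans A<C C<B))
    (fs f0)      (fs f0)      → <ᵇ-false (≤-refl {B})
    (fs f0)      (fs (fs f0)) → <ᵇ-false (<⇒≤ C<B)
    (fs (fs f0)) f0           → <ᵇ-false (<⇒≤ A<C)
    (fs (fs f0)) (fs f0)      → <ᵇ-true C<B
    (fs (fs f0)) (fs (fs f0)) → <ᵇ-false (≤-refl {C})

Has213⇔Occurs : ∀ {n f} → Has213 n f ⇔ Occurs p213 n f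
Has213⇔Occurs = mk⇔
  (λ (i , j , k , i<j , j<k , k<n , B<A , A<C) → i , j , k , i<j , j<k , k<n , table B<A A<C)
  (λ (i , j , k , i<j , j<k , k<n , same) →
     i , j , k , i<j , j<k , k<n , <ᵇ-true⁻ (same (fs f0) f0) , <ᵇ-true⁻ (same f0 (fs (fs f0))))
  where
  table : ∀ {A B C} → B < A → A < C → SameOrder p213 A B C
  table {A} {B} {C} B<A A<C = λ where
    f0           f0           → <ᵇ-false (≤-refl {A})
    f0           (fs f0)      → <ᵇ-false (<⇒≤ B<A)
    f0           (fs (fs f0)) → <ᵇ-true A<C
    (fs f0)      f0           → <ᵇ-true B<A
    (fs f0)      (fs f0)      → <ᵇ-false (≤-refl {B})
    (fs f0)      (fs (fs f0)) → <ᵇ-true (<-trans B<A A<C)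
    (fs (fs f0)) f0           → <ᵇ-false (<⇒≤ A<C)
    (fs (fs f0)) (fs f0)      → <ᵇ-false (<⇒≤ (<-trans B<A A<C))
    (fs (fs f0)) (fs (fs f0)) → <ᵇ-false (≤-refl {C})

avoids-spec : ∀ {n} (Has : ℕ → (ℕ → ℕ) → Set) (σ : Vec (Fin n) n) (π : Vec (Fin 3) 3) →
  (∀ {f} → Has n f ⇔ Occurs π n f) → avoids σ π ≡ true ⇔ (¬ Has n (at σ))
avoids-spec Has σ π has⇔occ = mk⇔ to from
  where
  to : avoids σ π ≡ true → ¬ Has _ (at σ)
  to e h with contains σ π | Equivalence.from (contains-spec σ π) (Equivalence.to has⇔occ h)
  to () h | true | _
  to e  h | false | ()
  from : ¬ Has _ (at σ) → avoids σ π ≡ true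
  from ¬h with contains σ π in c
  ... | true  = ⊥-elim (¬h (Equivalence.from has⇔occ (Equivalence.to (contains-spec σ π) c)))
  ... | false = refl

record IsFI (Has : ℕ → (ℕ → ℕ) → Set) (n : ℕ) (f : ℕ → ℕ) : Set where
  field
    injective      : Inj n f
    involutive     : Invol n f
    fixedPointFree : FixedPointFree n f
    avoiding       : ¬ Has n f

IsFI-agree : ∀ {Has N f g} → Agree N f g → Into N N f → (Has N g → Has N f) → IsFI Has N f → IsFI Has N g
IsFI-agree f≗g into has⇒ ι = record
  { injective      = Inj-agree f≗g (IsFI.injective ι)
  ; involutive     = Invol-agree f≗g into (IsFI.involutive ι)
  ; fixedPointFree = FixedPointFree-agree f≗g (IsFI.fixedPointFree ι)
  ; avoiding       = IsFI.avoiding ι ∘ has⇒ }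

FI-unique : (n : ℕ) {k : ℕ} (π : Vec (Fin k) k) → Unique (FI n π)
FI-unique n π = filter⁺ _ (allWords-unique n n)

FI-spec : ∀ {n} (Has : ℕ → (ℕ → ℕ) → Set) (π : Vec (Fin 3) 3) → (∀ {f} → Has n f ⇔ Occurs π n f) →
  ∀ {σ} → σ ∈ FI n π ⇔ IsFI Has n (at σ)
FI-spec {n} Has π has⇔occ {σ} = mk⇔ to from
  where
  cond : Vec (Fin n) n → Bool
  cond σ = isPerm σ ∧ isInvolution σ ∧ isFixedPointFree σ ∧ avoids σ π
  to : σ ∈ FI n π → IsFI Has n (at σ)
  to σ∈ = record
    { injective      = Equivalence.to (isPerm-spec σ) (∧-true⁻ˡ c)
    ; involutive     = Equivalence.to (isInvolution-spec σ) (∧-true⁻ˡ c₂)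
    ; fixedPointFree = Equivalence.to (isFixedPointFree-spec σ) (∧-true⁻ˡ c₃)
    ; avoiding       = Equivalence.to (avoids-spec Has σ π has⇔occ) (∧-true⁻ʳ {isFixedPointFree σ} c₃) }
    where
    c  = Equivalence.to T-≡ (proj₂ (∈-filter⁻ (λ σ → T? (cond σ)) {xs = allWords n n} σ∈))
    c₂ = ∧-true⁻ʳ {isPerm σ} c
    c₃ = ∧-true⁻ʳ {isInvolution σ} c₂
  from : IsFI Has n (at σ) → σ ∈ FI n π
  from ι = ∈-filter⁺ (λ σ → T? (cond σ)) (allWords-complete n n σ) (Equivalence.from T-≡
    (∧-true (Equivalence.from (isPerm-spec σ) (IsFI.injective ι))
    (∧-true (Equivalence.from (isInvolution-spec σ) (IsFI.involutive ι))
    (∧-true (Equivalence.from (isFixedPointFree-spec σ) (IsFI.fixedPointFree ι))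
            (Equivalence.from (avoids-spec Has σ π has⇔occ) (IsFI.avoiding ι))))))

Av : (n : ℕ) → List (Vec (Fin n) n)
Av n = filter (λ σ → T? (isPerm σ ∧ avoids σ p132)) (allWords n n)

Av-unique : (n : ℕ) → Unique (Av n)
Av-unique n = filter⁺ _ (allWords-unique n n)

Av-spec : ∀ {n} {σ : Vec (Fin n) n} → σ ∈ Av n ⇔ (Inj n (at σ) × ¬ Has132 n (at σ))
Av-spec {n} {σ} = mk⇔ to from
  where
  to : σ ∈ Av n → Inj n (at σ) × ¬ Has132 n (at σ)
  to σ∈ = Equivalence.to (isPerm-spec σ) (∧-true⁻ˡ c)
        , Equivalence.to (avoids-spec Has132 σ p132 Has132⇔Occurs) (∧-true⁻ʳ {isPerm σ} c)
    where c = Equivalence.to T-≡ (proj₂ (∈-filter⁻ (λ σ → T? (isPerm σ ∧ avoids σ p132)) {xs = allWords n n} σ∈))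
  from : Inj n (at σ) × ¬ Has132 n (at σ) → σ ∈ Av n
  from (inj , avoid) = ∈-filter⁺ (λ σ → T? (isPerm σ ∧ avoids σ p132)) (allWords-complete n n σ)
    (Equivalence.from T-≡ (∧-true (Equivalence.from (isPerm-spec σ) inj) (Equivalence.from (avoids-spec Has132 σ p132 Has132⇔Occurs) avoid)))

avPoly : ℕ → Poly
avPoly n t = count (λ σ → coinv σ ≡ᵇ t) (Av n)

∸-<-bound : ∀ {m x k} → m ≤ x → x < k + m → x ∸ m < k
∸-<-bound {m} {x} {k} m≤x x<k+m = subst (x ∸ m <_) (m+n∸n≡m k m) (∸-monoˡ-< x<k+m m≤x)

∸-reflect-< : ∀ {m x y} → m ≤ x → m ≤ y → x ∸ m < y ∸ m → x < y
∸-reflect-< {m} m≤x m≤y d = subst₂ _<_ (m∸n+n≡m m≤x) (m∸n+n≡m m≤y) (+-monoˡ-< m d)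

h+h≡h*2 : ∀ h → h + h ≡ h * 2
h+h≡h*2 h = trans (cong (h +_) (sym (+-identityʳ h))) (*-comm 2 h)

double-≡ᵇ : ∀ c j → ((c + c) ≡ᵇ j) ≡ (if j % 2 ≡ᵇ 0 then c ≡ᵇ (j / 2) else false)
double-≡ᵇ c j with j % 2 ≡ᵇ 0 in parity
... | true = ≡ᵇ-iff
      (λ c+c≡j → *-cancelʳ-≡ c (j / 2) 2 (trans (sym (h+h≡h*2 c)) (trans c+c≡j (trans j≡h+h (h+h≡h*2 (j / 2))))))
      (λ c≡h → trans (cong (λ z → z + z) c≡h) (sym j≡h+h))
  where
  j≡h+h : j ≡ j / 2 + j / 2
  j≡h+h = trans (m≡m%n+[m/n]*n j 2) (trans (cong (_+ (j / 2) * 2) (≡ᵇ-true⁻ parity)) (sym (h+h≡h*2 (j / 2))))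
... | false = ≡ᵇ-false {c + c} {j} (λ c+c≡j → ≡ᵇ-false⁻ parity
      (trans (cong (_% 2) (sym c+c≡j)) (trans (cong (_% 2) (h+h≡h*2 c)) (m*n%n≡0 c 2))))

count-double : {A : Set} (X : A → ℕ) (L : List A) (j : ℕ) →
  count (λ a → (X a + X a) ≡ᵇ j) L ≡ substSq (λ t → count (λ a → X a ≡ᵇ t) L) j
count-double X L j = trans (count-cong _ _ L (λ {a} _ → double-≡ᵇ (X a) j)) (cases (j % 2 ≡ᵇ 0))
  where
  cases : ∀ b → count (λ a → if b then X a ≡ᵇ (j / 2) else false) L
              ≡ (if b then count (λ a → X a ≡ᵇ (j / 2)) L else 0)
  cases true  = refl
  cases false = count-false _ L (λ _ → refl)

-- (A) Halving: FI_{m+m}(132) versus Av_m(132)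

pairing : ℕ → (ℕ → ℕ) → ℕ → ℕ
pairing m w i = if i <ᵇ m then w i + m else inverse m w (i ∸ m)

pairing-low : ∀ m w {i} → i < m → pairing m w i ≡ w i + m
pairing-low m w i<m rewrite <ᵇ-true i<m = refl

pairing-high : ∀ m w {i} → m ≤ i → pairing m w i ≡ inverse m w (i ∸ m)
pairing-high m w {i} m≤i rewrite <ᵇ-false {i} {m} m≤i = refl

pairing-high′ : ∀ m w t → pairing m w (m + t) ≡ inverse m w t
pairing-high′ m w t = trans (pairing-high m w (m≤m+n m t)) (cong (inverse m w) (m+n∸m≡n m t))

pairing-agree : ∀ m {w w′} → Agree m w w′ → ∀ i → pairing m w i ≡ pairing m w′ i
pairing-agree m {w} {w′} w≗w′ i with i <? m
... | yes i<m = trans (pairing-low m w i<m) (trans (cong (_+ m) (w≗w′ i<m)) (sym (pairing-low m w′ i<m)))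
... | no i≮m  = trans (pairing-high m w (≮⇒≥ i≮m))
    (trans (find-cong m _ _ (λ j<m → cong (_≡ᵇ (i ∸ m)) (w≗w′ j<m))) (sym (pairing-high m w′ (≮⇒≥ i≮m))))

-- In a fixed-point-free involution f, a position a < m
-- with f a < m and a position c ≥ m with f c ≥ m form an occurrence of 132:
-- (a , c , f c) if c < f c, and (a , f c , c) if f c < c.
low-high-132 : ∀ {N m f} → Invol N f → FixedPointFree N f → Into N N f →
  ∀ {a c} → a < m → f a < m → m ≤ c → c < N → m ≤ f c → Has132 N f
low-high-132 {f = f} invol fpf into {a} {c} a<m fa<m m≤c c<N m≤fc with <-cmp c (f c)
... | tri≈ _ c≡fc _ = ⊥-elim (fpf c<N (sym c≡fc))
... | tri< c<fc _ _ = a , c , f c , <-≤-trans a<m m≤c , c<fc , into c<N ,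
        subst (f a <_) (sym (invol c<N)) (<-≤-trans fa<m m≤c) ,
        subst (_< f c) (sym (invol c<N)) c<fc
... | tri> _ _ fc<c = a , f c , c , <-≤-trans a<m m≤fc , fc<c , c<N ,
        <-≤-trans fa<m m≤fc ,
        subst (f c <_) (sym (invol c<N)) fc<c

module Halving {m : ℕ} {f : ℕ → ℕ} (ι : IsFI Has132 (m + m) f) (into : Into (m + m) (m + m) f) where
  open IsFI ι

  low : ∀ {i} → i < m → i < m + m
  low i<m = <-≤-trans i<m (m≤m+n m m)

  high : ∀ {t} → t < m → m + t < m + m
  high t<m = +-monoʳ-< m t<m

  -- Otherwise f a < m for some a < m; by low-high-132 the second half is then
  -- mapped injectively into the first half, missing the value f a.
  low→high : ∀ {a} → a < m → m ≤ f a
  low→high {a} a<m with f a <? m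
  ... | no fa≮m = ≮⇒≥ fa≮m
  ... | yes fa<m with search m (λ t → m ≤ᵇ f (m + t))
  ...   | inj₁ (t , t<m , m≤fmt) = ⊥-elim (avoiding
            (low-high-132 involutive fixedPointFree into a<m fa<m (m≤m+n m t) (high t<m)
                          (≤ᵇ⇒≤ m _ (Equivalence.from T-≡ m≤fmt))))
  ...   | inj₂ none = ⊥-elim (<-irrefl refl
            (injection-< m m (f a) (λ t → f (m + t)) inj′ into′ fa<m miss))
    where
    inj′ : Inj m (λ t → f (m + t))
    inj′ s<m t<m e = +-cancelˡ-≡ m _ _ (injective (high s<m) (high t<m) e)
    into′ : Into m m (λ t → f (m + t))
    into′ {t} t<m = ≰⇒> (λ m≤ → subst T (none t t<m) (≤⇒≤ᵇ m≤))
    miss : ∀ {t} → t < m → f (m + t) ≢ f a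
    miss t<m e = <⇒≱ a<m (subst (m ≤_) (injective (high t<m) (low a<m) e) (m≤m+n m _))

  half : ℕ → ℕ
  half i = f i ∸ m

  half-inj : Inj m half
  half-inj i<m j<m e = injective (low i<m) (low j<m) (∸-cancelʳ-≡ (low→high i<m) (low→high j<m) e)

  half-into : Into m m half
  half-into i<m = ∸-<-bound (low→high i<m) (into (low i<m))

  half-avoid : ¬ Has132 m half
  half-avoid (i , j , k , i<j , j<k , k<m , a , b) = avoiding (i , j , k , i<j , j<k , low k<m ,
      ∸-reflect-< (low→high (<-trans i<j (<-trans j<k k<m))) (low→high k<m) a ,
      ∸-reflect-< (low→high k<m) (low→high (<-trans j<k k<m)) b)

  -- Every c ≥ m is f a for some a < m (half is onto), so f c = f (f a) = a < m.
  high→low : ∀ {c} → m ≤ c → c < m + m → f c < m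
  high→low {c} m≤c c<N with surjective m half half-inj half-into (∸-<-bound m≤c c<N)
  ... | a , a<m , fa∸m≡c∸m = subst (_< m) (trans (sym (involutive (low a<m))) (cong f fa≡c)) a<m
    where
    fa≡c : f a ≡ c
    fa≡c = ∸-cancelʳ-≡ (low→high a<m) m≤c fa∸m≡c∸m

  pairing-half : Agree (m + m) (pairing m half) f
  pairing-half {i} i<N with i <? m
  ... | yes i<m = trans (pairing-low m half i<m) (m∸n+n≡m (low→high i<m))
  ... | no i≮m = begin
      pairing m half i            ≡⟨ pairing-high m half m≤i ⟩
      inverse m half (i ∸ m)      ≡⟨ cong (inverse m half) (cong (_∸ m) (involutive i<N)) ⟨
      inverse m half (half (f i)) ≡⟨ inverse-left half-inj half-into (high→low m≤i i<N) ⟩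
      f i                         ∎
    where
    open ≡-Reasoning
    m≤i = ≮⇒≥ i≮m

module Pairing {m : ℕ} {w : ℕ → ℕ} (w-inj : Inj m w) (w-into : Into m m w) where
  private
    P = pairing m w
    w⁻¹ = inverse m w
    w⁻¹-into = inverse-into w-inj w-into
    ww⁻¹ = inverse-right w-inj w-into
    w⁻¹w = inverse-left w-inj w-into

  P-low : ∀ {i} → i < m → m ≤ P i
  P-low {i} i<m = subst (m ≤_) (sym (pairing-low m w i<m)) (m≤n+m m (w i))

  P-high : ∀ {i} → m ≤ i → i < m + m → P i < m
  P-high m≤i i<N = subst (_< m) (sym (pairing-high m w m≤i)) (w⁻¹-into (∸-<-bound m≤i i<N))

  P-into : Into (m + m) (m + m) P
  P-into {i} i<N with i <? m
  ... | yes i<m = subst (_< m + m) (sym (pairing-low m w i<m)) (+-monoˡ-< m (w-into i<m))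
  ... | no i≮m  = <-≤-trans (P-high (≮⇒≥ i≮m) i<N) (m≤m+n m m)

  P-inj : Inj (m + m) P
  P-inj {i} {j} i<N j<N e with i <? m | j <? m
  ... | yes i<m | yes j<m = w-inj i<m j<m
          (+-cancelʳ-≡ m (w i) (w j) (trans (sym (pairing-low m w i<m)) (trans e (pairing-low m w j<m))))
  ... | yes i<m | no j≮m  = ⊥-elim (<⇒≱ (P-high (≮⇒≥ j≮m) j<N) (subst (m ≤_) e (P-low i<m)))
  ... | no i≮m  | yes j<m = ⊥-elim (<⇒≱ (P-high (≮⇒≥ i≮m) i<N) (subst (m ≤_) (sym e) (P-low j<m)))
  ... | no i≮m  | no j≮m  = ∸-cancelʳ-≡ (≮⇒≥ i≮m) (≮⇒≥ j≮m) (begin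
      i ∸ m               ≡⟨ ww⁻¹ (∸-<-bound (≮⇒≥ i≮m) i<N) ⟨
      w (w⁻¹ (i ∸ m))     ≡⟨ cong w (trans (sym (pairing-high m w (≮⇒≥ i≮m))) (trans e (pairing-high m w (≮⇒≥ j≮m)))) ⟩
      w (w⁻¹ (j ∸ m))     ≡⟨ ww⁻¹ (∸-<-bound (≮⇒≥ j≮m) j<N) ⟩
      j ∸ m               ∎)
    where open ≡-Reasoning

  P-invol : Invol (m + m) P
  P-invol {i} i<N with i <? m
  ... | yes i<m = begin
      P (P i)             ≡⟨ cong P (pairing-low m w i<m) ⟩
      P (w i + m)         ≡⟨ cong P (+-comm (w i) m) ⟩
      P (m + w i)         ≡⟨ pairing-high′ m w (w i) ⟩
      w⁻¹ (w i)           ≡⟨ w⁻¹w i<m ⟩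
      i                   ∎
    where open ≡-Reasoning
  ... | no i≮m = begin
      P (P i)             ≡⟨ pairing-low m w (P-high m≤i i<N) ⟩
      w (P i) + m         ≡⟨ cong (λ z → w z + m) (pairing-high m w m≤i) ⟩
      w (w⁻¹ (i ∸ m)) + m ≡⟨ cong (_+ m) (ww⁻¹ (∸-<-bound m≤i i<N)) ⟩
      i ∸ m + m           ≡⟨ m∸n+n≡m m≤i ⟩
      i                   ∎
    where
    open ≡-Reasoning
    m≤i = ≮⇒≥ i≮m

  P-fpf : FixedPointFree (m + m) P
  P-fpf {i} i<N Pi≡i with i <? m
  ... | yes i<m = <⇒≱ i<m (subst (m ≤_) Pi≡i (P-low i<m))
  ... | no i≮m  = <⇒≱ (P-high (≮⇒≥ i≮m) i<N) (subst (m ≤_) (sym Pi≡i) (≮⇒≥ i≮m))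

  -- An occurrence of 132 in P lies inside one half (a first entry in the first
  -- half and a last one in the second would be in the wrong order); in the first
  -- half it is one of w, in the second one of w⁻¹, hence again one of w.
  P-avoid : ¬ Has132 m w → ¬ Has132 (m + m) P
  P-avoid w-avoid (p , q , r , p<q , q<r , r<N , Pp<Pr , Pr<Pq) with r <? m
  ... | yes r<m = w-avoid (p , q , r , p<q , q<r , r<m ,
          +-cancelʳ-< m (w p) (w r) (subst₂ _<_ (pairing-low m w p<m) (pairing-low m w r<m) Pp<Pr) ,
          +-cancelʳ-< m (w r) (w q) (subst₂ _<_ (pairing-low m w r<m) (pairing-low m w q<m) Pr<Pq))
    where q<m = <-trans q<r r<m
          p<m = <-trans p<q q<m
  ... | no r≮m with p <? m
  ...   | yes p<m = <⇒≱ (<-trans Pp<Pr (P-high (≮⇒≥ r≮m) r<N)) (P-low p<m)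
  ...   | no p≮m = w-avoid (w⁻¹ p′ , w⁻¹ r′ , w⁻¹ q′ ,
            subst₂ _<_ (pairing-high m w m≤p) (pairing-high m w m≤r) Pp<Pr ,
            subst₂ _<_ (pairing-high m w m≤r) (pairing-high m w m≤q) Pr<Pq ,
            w⁻¹-into q′<m ,
            subst₂ _<_ (sym (ww⁻¹ p′<m)) (sym (ww⁻¹ q′<m)) (∸-monoˡ-< p<q m≤p) ,
            subst₂ _<_ (sym (ww⁻¹ q′<m)) (sym (ww⁻¹ r′<m)) (∸-monoˡ-< q<r m≤q))
    where
    m≤r = ≮⇒≥ r≮m
    m≤p = ≮⇒≥ p≮m
    m≤q = <⇒≤ (<-≤-trans (s≤s m≤p) p<q)
    p′ = p ∸ m
    q′ = q ∸ m
    r′ = r ∸ m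
    r′<m = ∸-<-bound m≤r r<N
    q′<m = ∸-<-bound m≤q (<-trans q<r r<N)
    p′<m = ∸-<-bound m≤p (<-trans p<q (<-trans q<r r<N))

  P-isFI : ¬ Has132 m w → IsFI Has132 (m + m) P
  P-isFI w-avoid = record
    { injective = P-inj ; involutive = P-invol ; fixedPointFree = P-fpf ; avoiding = P-avoid w-avoid }

  -- Coinversions.  A row i < m of P counts the coinversions of w in row i; a
  -- row m + i counts those of w⁻¹ in row i; and w⁻¹ has as many as w.
  row-low : ∀ i → i < m → S (m + m) (coinvPair P i) ≡ S m (coinvPair w i)
  row-low i i<m = begin
      S (m + m) (coinvPair P i)
        ≡⟨ S-split m m _ ⟩
      S m (coinvPair P i) + S m (λ t → coinvPair P i (m + t))
        ≡⟨ cong₂ _+_ (S-cong m _ _ (λ j j<m → coinvPair-eval P i j refl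
                       (trans (cong₂ _<ᵇ_ (pairing-low m w i<m) (pairing-low m w j<m)) (+-<ᵇ-cancelʳ (w i) (w j) m))))
                     (S-zero m _ (λ t t<m → coinvPair-desc P i (m + t)
                       (<⇒≤ (<-≤-trans (P-high (m≤m+n m t) (+-monoʳ-< m t<m)) (P-low i<m))))) ⟩
      S m (coinvPair w i) + 0
        ≡⟨ +-identityʳ _ ⟩
      S m (coinvPair w i) ∎
    where open ≡-Reasoning

  row-high : ∀ i → i < m → S (m + m) (coinvPair P (m + i)) ≡ S m (coinvPair w⁻¹ i)
  row-high i i<m = begin
      S (m + m) (coinvPair P (m + i))
        ≡⟨ S-split m m _ ⟩
      S m (coinvPair P (m + i)) + S m (λ t → coinvPair P (m + i) (m + t))
        ≡⟨ cong₂ _+_ (S-zero m _ (λ j j<m → coinvPair-back P (m + i) j (≤-trans (<⇒≤ j<m) (m≤m+n m i))))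
                     (S-cong m _ _ (λ t _ → coinvPair-eval P (m + i) (m + t) (+-<ᵇ-cancelˡ m i t)
                       (cong₂ _<ᵇ_ (pairing-high′ m w i) (pairing-high′ m w t)))) ⟩
      0 + S m (coinvPair w⁻¹ i) ∎
    where open ≡-Reasoning

  coinv-inverse : coinvOn m w⁻¹ ≡ coinvOn m w
  coinv-inverse = begin
      S m (λ x → S m (coinvPair w⁻¹ x))
        ≡⟨ S-reindex w-inj w-into (λ x → S m (coinvPair w⁻¹ x)) ⟩
      S m (λ a → S m (coinvPair w⁻¹ (w a)))
        ≡⟨ S-cong m _ _ (λ a _ → S-reindex w-inj w-into (coinvPair w⁻¹ (w a))) ⟩
      S m (λ a → S m (λ b → coinvPair w⁻¹ (w a) (w b)))
        ≡⟨ S-cong m _ _ (λ a a<m → S-cong m _ _ (λ b b<m →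
             trans (coinvPair-eval w⁻¹ (w a) (w b) refl (cong₂ _<ᵇ_ (w⁻¹w a<m) (w⁻¹w b<m)))
                   (cong ind (∧-comm (w a <ᵇ w b) (a <ᵇ b))))) ⟩
      S m (λ a → S m (coinvPair w a)) ∎
    where open ≡-Reasoning

  P-coinv : coinvOn (m + m) P ≡ coinvOn m w + coinvOn m w
  P-coinv = begin
      S (m + m) (λ i → S (m + m) (coinvPair P i))
        ≡⟨ S-split m m _ ⟩
      S m (λ i → S (m + m) (coinvPair P i)) + S m (λ i → S (m + m) (coinvPair P (m + i)))
        ≡⟨ cong₂ _+_ (S-cong m _ _ row-low) (S-cong m _ _ row-high) ⟩
      coinvOn m w + coinvOn m w⁻¹
        ≡⟨ cong (coinvOn m w +_) coinv-inverse ⟩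
      coinvOn m w + coinvOn m w ∎
    where open ≡-Reasoning

FI132-spec : ∀ {n} {σ : Vec (Fin n) n} → σ ∈ FI n p132 ⇔ IsFI Has132 n (at σ)
FI132-spec = FI-spec Has132 p132 Has132⇔Occurs

FI213-spec : ∀ {n} {σ : Vec (Fin n) n} → σ ∈ FI n p213 ⇔ IsFI Has213 n (at σ)
FI213-spec = FI-spec Has213 p213 Has213⇔Occurs

module HalvingBijection (m : ℕ) where

  toInvolution : Vec (Fin m) m → Vec (Fin (m + m)) (m + m)
  toInvolution w = build (m + m) (pairing m (at w))

  module _ {w : Vec (Fin m) m} (w∈ : w ∈ Av m) where
    private
      w-inj = proj₁ (Equivalence.to Av-spec w∈)
      w-avoid = proj₂ (Equivalence.to Av-spec w∈)
    open Pairing w-inj (at-into w)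

    toInvolution-agree : Agree (m + m) (at (toInvolution w)) (pairing m (at w))
    toInvolution-agree = at-build (m + m) _ P-into

    toInvolution-∈ : toInvolution w ∈ FI (m + m) p132
    toInvolution-∈ = Equivalence.from FI132-spec (IsFI-agree (Agree-sym toInvolution-agree) P-into
      (Has132-agree (Agree-sym toInvolution-agree)) (P-isFI w-avoid))

    toInvolution-coinv : coinv (toInvolution w) ≡ coinv w + coinv w
    toInvolution-coinv = begin
        coinv (toInvolution w)                ≡⟨ coinv-at (toInvolution w) ⟩
        coinvOn (m + m) (at (toInvolution w)) ≡⟨ coinvOn-agree toInvolution-agree ⟩
        coinvOn (m + m) (pairing m (at w))    ≡⟨ P-coinv ⟩
        coinvOn m (at w) + coinvOn m (at w)   ≡⟨ cong (λ c → c + c) (coinv-at w) ⟨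
        coinv w + coinv w                     ∎
      where open ≡-Reasoning

    toInvolution-low : ∀ {i} → i < m → at (toInvolution w) i ∸ m ≡ at w i
    toInvolution-low {i} i<m = trans
      (cong (_∸ m) (trans (toInvolution-agree (<-≤-trans i<m (m≤m+n m m))) (pairing-low m (at w) i<m)))
      (m+n∸n≡m (at w i) m)

  toInvolution-injective : ∀ {w w′} → w ∈ Av m → w′ ∈ Av m → toInvolution w ≡ toInvolution w′ → w ≡ w′
  toInvolution-injective {w} {w′} w∈ w′∈ e = at-injective w w′ (λ {i} i<m →
    trans (sym (toInvolution-low w∈ i<m)) (trans (cong (λ v → at v i ∸ m) e) (toInvolution-low w′∈ i<m)))

  toInvolution-onto : ∀ {σ} → σ ∈ FI (m + m) p132 → ∃[ w ] (w ∈ Av m × toInvolution w ≡ σ)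
  toInvolution-onto {σ} σ∈ = w , w∈ , at-injective (toInvolution w) σ agree
    where
    ι = Equivalence.to FI132-spec σ∈
    open Halving {m} ι (at-into σ)
    w = build m half
    w≗half : Agree m (at w) half
    w≗half = at-build m half half-into
    w∈ : w ∈ Av m
    w∈ = Equivalence.from Av-spec (Inj-agree (Agree-sym w≗half) half-inj , half-avoid ∘ Has132-agree (Agree-sym w≗half))
    agree : Agree (m + m) (at (toInvolution w)) (at σ)
    agree {i} i<N = trans (toInvolution-agree w∈ i<N) (trans (pairing-agree m w≗half i) (pairing-half i<N))

halving-count : (m j : ℕ) → count (λ σ → coinv σ ≡ᵇ j) (FI (m + m) p132) ≡ substSq (avPoly m) j
halving-count m j = begin
    count (λ σ → coinv σ ≡ᵇ j) (FI (m + m) p132)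
      ≡⟨ bijection-count (λ σ → coinv σ ≡ᵇ j) toInvolution (Av-unique m) (FI-unique (m + m) p132)
           toInvolution-∈ toInvolution-onto toInvolution-injective ⟨
    count (λ w → coinv (toInvolution w) ≡ᵇ j) (Av m)
      ≡⟨ count-cong _ _ (Av m) (λ w∈ → cong (_≡ᵇ j) (toInvolution-coinv w∈)) ⟩
    count (λ w → (coinv w + coinv w) ≡ᵇ j) (Av m)
      ≡⟨ count-double coinv (Av m) j ⟩
    substSq (avPoly m) j ∎
  where
  open ≡-Reasoning
  open HalvingBijection m

-- (B) Decomposition of Av_N(132) at the maximum

join : ℕ → ℕ → (ℕ → ℕ) → (ℕ → ℕ) → ℕ → ℕ
join k r α β i = if i <ᵇ k then α i + r else (if i ≡ᵇ k then k + r else β (i ∸ suc k))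

module _ (k r : ℕ) (α β : ℕ → ℕ) where

  join-low : ∀ {i} → i < k → join k r α β i ≡ α i + r
  join-low i<k rewrite <ᵇ-true i<k = refl

  join-mid : join k r α β k ≡ k + r
  join-mid rewrite <ᵇ-false (≤-refl {k}) | ≡ᵇ-true {k} refl = refl

  join-high : ∀ {i} → k < i → join k r α β i ≡ β (i ∸ suc k)
  join-high {i} k<i rewrite <ᵇ-false {i} {k} (<⇒≤ k<i) | ≡ᵇ-false {i} {k} (λ i≡k → <-irrefl (sym i≡k) k<i) = refl

  join-high′ : ∀ t → join k r α β (suc k + t) ≡ β t
  join-high′ t = trans (join-high (m≤m+n (suc k) t)) (cong β (m+n∸m≡n (suc k) t))

module Positions (k r : ℕ) where

  N : ℕ
  N = k + suc r

  k<N : k < N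
  k<N = subst (k <_) (sym (+-suc k r)) (s≤s (m≤m+n k r))

  low : ∀ {i} → i < k → i < N
  low i<k = <-trans i<k k<N

  high : ∀ {t} → t < r → suc k + t < N
  high {t} t<r = subst (suc k + t <_) (sym (+-suc k r)) (+-monoʳ-< (suc k) t<r)

  high⁻¹ : ∀ {i} → k < i → i < N → i ∸ suc k < r
  high⁻¹ {i} k<i i<N = +-cancelˡ-< (suc k) (i ∸ suc k) r (subst₂ _<_ (sym (m+[n∸m]≡n k<i)) (+-suc k r) i<N)

  top<N : k + r < N
  top<N = subst (k + r <_) (sym (+-suc k r)) ≤-refl

  S-positions : (g : ℕ → ℕ) → S N g ≡ S k g + (g k + S r (λ t → g (suc k + t)))
  S-positions g = trans (S-split k (suc r) g)
    (cong (S k g +_) (cong₂ _+_ (cong g (+-identityʳ k)) (S-cong r _ _ (λ t _ → cong g (+-suc k t)))))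

join-agree : ∀ k r {α α′ β β′} → Agree k α α′ → Agree r β β′ →
  Agree (k + suc r) (join k r α β) (join k r α′ β′)
join-agree k r {α} {α′} {β} {β′} α≗α′ β≗β′ {i} i<N with <-cmp i k
... | tri< i<k _ _ = trans (join-low k r α β i<k) (trans (cong (_+ r) (α≗α′ i<k)) (sym (join-low k r α′ β′ i<k)))
... | tri≈ _ refl _ = trans (join-mid k r α β) (sym (join-mid k r α′ β′))
... | tri> _ _ k<i = trans (join-high k r α β k<i)
      (trans (β≗β′ (Positions.high⁻¹ k r k<i i<N)) (sym (join-high k r α′ β′ k<i)))

-- Joining two 132-avoiding permutations gives a 132-avoiding permutation with
-- k + coinv α + coinv β coinversions (each of the k entries before the maximum
-- forms a coinversion with it; there are none across the maximum).
module Join {k r : ℕ} {α β : ℕ → ℕ} (α-inj : Inj k α) (α-into : Into k k α) (β-inj : Inj r β) (β-into : Into r r β) where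
  open Positions k r
  private
    J = join k r α β

  J-low-range : ∀ {i} → i < k → r ≤ J i × J i < k + r
  J-low-range {i} i<k = subst (r ≤_) (sym (join-low k r α β i<k)) (m≤n+m r (α i))
                      , subst (_< k + r) (sym (join-low k r α β i<k)) (+-monoˡ-< r (α-into i<k))

  J-high-range : ∀ {i} → k < i → i < N → J i < r
  J-high-range k<i i<N = subst (_< r) (sym (join-high k r α β k<i)) (β-into (high⁻¹ k<i i<N))

  J-into : Into N N J
  J-into {i} i<N with <-cmp i k
  ... | tri< i<k _ _ = <-trans (proj₂ (J-low-range i<k)) top<N
  ... | tri≈ _ refl _ = subst (_< N) (sym (join-mid k r α β)) top<N
  ... | tri> _ _ k<i = <-≤-trans (J-high-range k<i i<N) (≤-trans (m≤n+m r k) (<⇒≤ top<N))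

  J≤top : ∀ {i} → i < N → J i ≤ k + r
  J≤top {i} i<N = s≤s⁻¹ (subst (J i <_) (+-suc k r) (J-into i<N))

  J-inj : Inj N J
  J-inj {i} {j} i<N j<N e with <-cmp i k | <-cmp j k
  ... | tri< i<k _ _ | tri< j<k _ _ =
        α-inj i<k j<k (+-cancelʳ-≡ r _ _ (trans (sym (join-low k r α β i<k)) (trans e (join-low k r α β j<k))))
  ... | tri< i<k _ _ | tri≈ _ refl _ = ⊥-elim (<-irrefl (trans e (join-mid k r α β)) (proj₂ (J-low-range i<k)))
  ... | tri< i<k _ _ | tri> _ _ k<j = ⊥-elim (<⇒≱ (J-high-range k<j j<N) (subst (r ≤_) e (proj₁ (J-low-range i<k))))
  ... | tri≈ _ refl _ | tri< j<k _ _ = ⊥-elim (<-irrefl (trans (sym e) (join-mid k r α β)) (proj₂ (J-low-range j<k)))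
  ... | tri≈ _ refl _ | tri≈ _ refl _ = refl
  ... | tri≈ _ refl _ | tri> _ _ k<j =
        ⊥-elim (<⇒≱ (J-high-range k<j j<N) (subst (r ≤_) (trans (sym (join-mid k r α β)) e) (m≤n+m r k)))
  ... | tri> _ _ k<i | tri< j<k _ _ = ⊥-elim (<⇒≱ (J-high-range k<i i<N) (subst (r ≤_) (sym e) (proj₁ (J-low-range j<k))))
  ... | tri> _ _ k<i | tri≈ _ refl _ =
        ⊥-elim (<⇒≱ (J-high-range k<i i<N) (subst (r ≤_) (trans (sym (join-mid k r α β)) (sym e)) (m≤n+m r k)))
  ... | tri> _ _ k<i | tri> _ _ k<j = ∸-cancelʳ-≡ k<i k<j (β-inj (high⁻¹ k<i i<N) (high⁻¹ k<j j<N)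
        (trans (sym (join-high k r α β k<i)) (trans e (join-high k r α β k<j))))

  -- An occurrence of 132 cannot use the maximum as its first or last entry, nor
  -- start before the maximum and end after it; so it lies inside α or inside β.
  J-avoid : ¬ Has132 k α → ¬ Has132 r β → ¬ Has132 N J
  J-avoid α-avoid β-avoid (p , q , s , p<q , q<s , s<N , Jp<Js , Js<Jq) with <-cmp s k
  ... | tri< s<k _ _ = α-avoid (p , q , s , p<q , q<s , s<k ,
          +-cancelʳ-< r _ _ (subst₂ _<_ (join-low k r α β p<k) (join-low k r α β s<k) Jp<Js) ,
          +-cancelʳ-< r _ _ (subst₂ _<_ (join-low k r α β s<k) (join-low k r α β q<k) Js<Jq))
    where q<k = <-trans q<s s<k
          p<k = <-trans p<q q<k
  ... | tri≈ _ refl _ = <⇒≱ Js<Jq (subst (J q ≤_) (sym (join-mid k r α β)) (J≤top (<-trans q<s s<N)))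
  ... | tri> _ _ k<s with <-cmp p k
  ...   | tri< p<k _ _ = <⇒≱ (<-trans Jp<Js (J-high-range k<s s<N)) (proj₁ (J-low-range p<k))
  ...   | tri≈ _ refl _ = <⇒≱ Jp<Js (subst (J s ≤_) (sym (join-mid k r α β)) (J≤top s<N))
  ...   | tri> _ _ k<p = β-avoid (p ∸ suc k , q ∸ suc k , s ∸ suc k ,
          ∸-monoˡ-< p<q k<p , ∸-monoˡ-< q<s k<q , high⁻¹ k<s s<N ,
          subst₂ _<_ (join-high k r α β k<p) (join-high k r α β k<s) Jp<Js ,
          subst₂ _<_ (join-high k r α β k<s) (join-high k r α β k<q) Js<Jq)
    where k<q = <-trans k<p p<q

  row-low : ∀ i → i < k → S N (coinvPair J i) ≡ S k (coinvPair α i) + 1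
  row-low i i<k = trans (S-positions (coinvPair J i)) (cong₂ _+_
      (S-cong k _ _ (λ j j<k → coinvPair-eval J i j refl
        (trans (cong₂ _<ᵇ_ (join-low k r α β i<k) (join-low k r α β j<k)) (+-<ᵇ-cancelʳ (α i) (α j) r))))
      (trans (cong₂ _+_
          (coinvPair-eval J i k (<ᵇ-true i<k) (<ᵇ-true (subst (J i <_) (sym (join-mid k r α β)) (proj₂ (J-low-range i<k)))))
          (S-zero r _ (λ t t<r → coinvPair-desc J i (suc k + t)
            (<⇒≤ (<-≤-trans (J-high-range (s≤s (m≤m+n k t)) (high t<r)) (proj₁ (J-low-range i<k)))))))
        (+-identityʳ 1)))

  row-mid : S N (coinvPair J k) ≡ 0
  row-mid = S-zero N _ (λ j j<N → coinvPair-desc J k j (subst (J j ≤_) (sym (join-mid k r α β)) (J≤top j<N)))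

  row-high : ∀ t → t < r → S N (coinvPair J (suc k + t)) ≡ S r (coinvPair β t)
  row-high t t<r = trans (S-positions (coinvPair J (suc k + t))) (cong₂ _+_
      (S-zero k _ (λ j j<k → coinvPair-back J (suc k + t) j (≤-trans (<⇒≤ j<k) k≤)))
      (cong₂ _+_ (coinvPair-back J (suc k + t) k k≤)
        (S-cong r _ _ (λ u _ → coinvPair-eval J (suc k + t) (suc k + u) (+-<ᵇ-cancelˡ (suc k) t u)
          (cong₂ _<ᵇ_ (join-high′ k r α β t) (join-high′ k r α β u))))))
    where k≤ : k ≤ suc k + t
          k≤ = ≤-trans (n≤1+n k) (m≤m+n (suc k) t)

  J-coinv : coinvOn N J ≡ k + (coinvOn k α + coinvOn r β)
  J-coinv = begin
      S N (λ i → S N (coinvPair J i))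
        ≡⟨ S-positions (λ i → S N (coinvPair J i)) ⟩
      S k (λ i → S N (coinvPair J i)) + (S N (coinvPair J k) + S r (λ t → S N (coinvPair J (suc k + t))))
        ≡⟨ cong₂ _+_ (S-cong k _ _ row-low) (cong₂ _+_ row-mid (S-cong r _ _ row-high)) ⟩
      S k (λ i → S k (coinvPair α i) + 1) + (0 + coinvOn r β)
        ≡⟨ cong (_+ coinvOn r β) (trans (S-+ k _ _) (cong (coinvOn k α +_) (trans (S-const k 1) (*-identityʳ k)))) ⟩
      (coinvOn k α + k) + coinvOn r β
        ≡⟨ cong (_+ coinvOn r β) (+-comm (coinvOn k α) k) ⟩
      (k + coinvOn k α) + coinvOn r β
        ≡⟨ +-assoc k _ _ ⟩
      k + (coinvOn k α + coinvOn r β) ∎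
    where open ≡-Reasoning

module Split {k r : ℕ} {f : ℕ → ℕ} (inj : Inj (k + suc r) f) (into : Into (k + suc r) (k + suc r) f)
             (avoid : ¬ Has132 (k + suc r) f) (f-max : f k ≡ k + r) where
  open Positions k r

  below-max : ∀ {l} → l < N → l ≢ k → f l < k + r
  below-max {l} l<N l≢k = ≤∧≢⇒< (s≤s⁻¹ (subst (f l <_) (+-suc k r) (into l<N)))
                                (λ e → l≢k (inj l<N k<N (trans e (sym f-max))))

  -- Entries before the maximum exceed entries after it: otherwise they form a
  -- 132 with the maximum in the middle.
  before>after : ∀ {i l} → i < k → k < l → l < N → f l < f i
  before>after {i} {l} i<k k<l l<N with <-cmp (f i) (f l)
  ... | tri> _ _ fl<fi = fl<fi
  ... | tri≈ _ fi≡fl _ = ⊥-elim (<-irrefl (inj (low i<k) l<N fi≡fl) (<-trans i<k k<l))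
  ... | tri< fi<fl _ _ = ⊥-elim (avoid (i , k , l , i<k , k<l , l<N , fi<fl ,
          subst (f l <_) (sym f-max) (below-max l<N (λ l≡k → <-irrefl (sym l≡k) k<l))))

  after : ℕ → ℕ
  after t = f (suc k + t)

  after-inj : Inj r after
  after-inj s<r t<r e = +-cancelˡ-≡ (suc k) _ _ (inj (high s<r) (high t<r) e)

  after-avoid : ¬ Has132 r after
  after-avoid (p , q , s , p<q , q<s , s<r , a , b) = avoid (suc k + p , suc k + q , suc k + s ,
     +-monoʳ-< (suc k) p<q , +-monoʳ-< (suc k) q<s , high s<r , a , b)

  -- An entry before the maximum exceeds the r distinct entries after it.
  before≥r : ∀ {i} → i < k → r ≤ f i
  before≥r i<k = injection-≤ r _ after after-inj (λ t<r → before>after i<k (s≤s (m≤m+n k _)) (high t<r))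

  -- An entry after the maximum lies below the k distinct entries before it,
  -- all of which lie below k + r; so it is < r.
  after<r : ∀ {l} → k < l → l < N → f l < r
  after<r {l} k<l l<N with f l <? r
  ... | yes fl<r = fl<r
  ... | no fl≮r = ⊥-elim (<⇒≱ (s≤s (≮⇒≥ fl≮r)) (+-cancelˡ-≤ k _ _ room))
    where
    fl<top : f l < k + r
    fl<top = below-max l<N (λ l≡k → <-irrefl (sym l≡k) k<l)
    -- the entries before the maximum, shifted down into [0, k + r − f l − 1)
    k≤gap : k ≤ k + r ∸ suc (f l)
    k≤gap = injection-≤ k _ (λ i → f i ∸ suc (f l))
      (λ i<k j<k e → inj (low i<k) (low j<k)
         (∸-cancelʳ-≡ (before>after i<k k<l l<N) (before>after j<k k<l l<N) e))
      (λ i<k → ∸-monoˡ-< (below-max (low i<k) (λ i≡k → <-irrefl i≡k i<k)) (before>after i<k k<l l<N))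
    room : k + suc (f l) ≤ k + r
    room = subst (k + suc (f l) ≤_) (m∸n+n≡m fl<top) (+-monoˡ-≤ (suc (f l)) k≤gap)

  after-into : Into r r after
  after-into t<r = after<r (s≤s (m≤m+n k _)) (high t<r)

  before : ℕ → ℕ
  before i = f i ∸ r

  before-inj : Inj k before
  before-inj i<k j<k e = inj (low i<k) (low j<k) (∸-cancelʳ-≡ (before≥r i<k) (before≥r j<k) e)

  before-into : Into k k before
  before-into i<k = ∸-<-bound (before≥r i<k) (below-max (low i<k) (λ i≡k → <-irrefl i≡k i<k))

  before-avoid : ¬ Has132 k before
  before-avoid (p , q , s , p<q , q<s , s<k , a , b) = avoid (p , q , s , p<q , q<s , low s<k ,
     ∸-reflect-< (before≥r (<-trans p<q (<-trans q<s s<k))) (before≥r s<k) a ,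
     ∸-reflect-< (before≥r s<k) (before≥r (<-trans q<s s<k)) b)

  join-split : Agree N (join k r before after) f
  join-split {i} i<N with <-cmp i k
  ... | tri< i<k _ _ = trans (join-low k r before after i<k) (m∸n+n≡m (before≥r i<k))
  ... | tri≈ _ refl _ = trans (join-mid k r before after) (sym f-max)
  ... | tri> _ _ k<i = trans (join-high k r before after k<i) (cong f (m+[n∸m]≡n k<i))

maxPos : ∀ {N} → Vec (Fin N) N → ℕ
maxPos {N} σ = inverse N (at σ) (pred N)

maxPos-spec : ∀ {N} (σ : Vec (Fin N) N) → Inj N (at σ) → pred N < N → maxPos σ < N × at σ (maxPos σ) ≡ pred N
maxPos-spec σ inj top<N = inverse-into inj (at-into σ) top<N , inverse-right inj (at-into σ) top<N

maxClassPoly : ℕ → ℕ → Poly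
maxClassPoly N k j = count (λ σ → coinv σ ≡ᵇ j) (filter (λ σ → T? (maxPos σ ≡ᵇ k)) (Av N))

module Decomposition (k r : ℕ) where
  open Positions k r

  pred-N : pred N ≡ k + r
  pred-N = cong pred (+-suc k r)

  maxAt : List (Vec (Fin N) N)
  maxAt = filter (λ σ → T? (maxPos σ ≡ᵇ k)) (Av N)

  pairs : List (Vec (Fin k) k × Vec (Fin r) r)
  pairs = cartesianProduct (Av k) (Av r)

  combine : Vec (Fin k) k × Vec (Fin r) r → Vec (Fin N) N
  combine (a , b) = build N (join k r (at a) (at b))

  module _ {a : Vec (Fin k) k} {b : Vec (Fin r) r} (a∈ : a ∈ Av k) (b∈ : b ∈ Av r) where
    private
      a-inj = proj₁ (Equivalence.to Av-spec a∈)
      b-inj = proj₁ (Equivalence.to Av-spec b∈)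
    open Join a-inj (at-into a) b-inj (at-into b)

    combine-agree : Agree N (at (combine (a , b))) (join k r (at a) (at b))
    combine-agree = at-build N _ J-into

    combine-inj : Inj N (at (combine (a , b)))
    combine-inj = Inj-agree (Agree-sym combine-agree) J-inj

    combine-∈ : combine (a , b) ∈ maxAt
    combine-∈ = ∈-filter⁺ (λ σ → T? (maxPos σ ≡ᵇ k))
      (Equivalence.from Av-spec (combine-inj , J-avoid (proj₂ (Equivalence.to Av-spec a∈)) (proj₂ (Equivalence.to Av-spec b∈))
                                               ∘ Has132-agree (Agree-sym combine-agree)))
      (Equivalence.from T-≡ (≡ᵇ-true maxPos≡k))
      where
      max-at-k : at (combine (a , b)) k ≡ pred N
      max-at-k = trans (combine-agree k<N) (trans (join-mid k r (at a) (at b)) (sym pred-N))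
      maxPos≡k : maxPos (combine (a , b)) ≡ k
      maxPos≡k = trans (cong (inverse N (at (combine (a , b)))) (sym max-at-k)) (inverse-left combine-inj (at-into (combine (a , b))) k<N)

    combine-coinv : coinv (combine (a , b)) ≡ k + (coinv a + coinv b)
    combine-coinv = begin
        coinv (combine (a , b))                   ≡⟨ coinv-at (combine (a , b)) ⟩
        coinvOn N (at (combine (a , b)))          ≡⟨ coinvOn-agree combine-agree ⟩
        coinvOn N (join k r (at a) (at b))        ≡⟨ J-coinv ⟩
        k + (coinvOn k (at a) + coinvOn r (at b)) ≡⟨ cong₂ (λ x y → k + (x + y)) (coinv-at a) (coinv-at b) ⟨
        k + (coinv a + coinv b)                   ∎
      where open ≡-Reasoning

    combine-low : ∀ {i} → i < k → at (combine (a , b)) i ∸ r ≡ at a i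
    combine-low {i} i<k = trans (cong (_∸ r) (trans (combine-agree (low i<k)) (join-low k r (at a) (at b) i<k)))
                                (m+n∸n≡m (at a i) r)

    combine-high : ∀ {t} → t < r → at (combine (a , b)) (suc k + t) ≡ at b t
    combine-high {t} t<r = trans (combine-agree (high t<r)) (join-high′ k r (at a) (at b) t)

  combine-injective : ∀ {ab ab′} → ab ∈ pairs → ab′ ∈ pairs → combine ab ≡ combine ab′ → ab ≡ ab′
  combine-injective {a , b} {a′ , b′} ab∈ ab′∈ e
    with ∈-cartesianProduct⁻ (Av k) (Av r) ab∈ | ∈-cartesianProduct⁻ (Av k) (Av r) ab′∈
  ... | a∈ , b∈ | a′∈ , b′∈ = cong₂ _,_
      (at-injective a a′ (λ {i} i<k → trans (sym (combine-low a∈ b∈ i<k))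
        (trans (cong (λ v → at v i ∸ r) e) (combine-low a′∈ b′∈ i<k))))
      (at-injective b b′ (λ {t} t<r → trans (sym (combine-high a∈ b∈ t<r))
        (trans (cong (λ v → at v (suc k + t)) e) (combine-high a′∈ b′∈ t<r))))

  combine-into : ∀ {ab} → ab ∈ pairs → combine ab ∈ maxAt
  combine-into {a , b} ab∈ = combine-∈ (proj₁ (∈-cartesianProduct⁻ (Av k) (Av r) ab∈)) (proj₂ (∈-cartesianProduct⁻ (Av k) (Av r) ab∈))

  combine-onto : ∀ {σ} → σ ∈ maxAt → ∃[ ab ] (ab ∈ pairs × combine ab ≡ σ)
  combine-onto {σ} σ∈ = (a , b) , ∈-cartesianProduct⁺ a∈ b∈ , at-injective (combine (a , b)) σ agree
    where
    σ∈Av = proj₁ (∈-filter⁻ (λ σ → T? (maxPos σ ≡ᵇ k)) {xs = Av N} σ∈)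
    maxPos≡k : maxPos σ ≡ k
    maxPos≡k = ≡ᵇ-true⁻ (Equivalence.to T-≡ (proj₂ (∈-filter⁻ (λ σ → T? (maxPos σ ≡ᵇ k)) {xs = Av N} σ∈)))
    σ-inj = proj₁ (Equivalence.to Av-spec σ∈Av)
    f-max : at σ k ≡ k + r
    f-max = trans (cong (at σ) (sym maxPos≡k))
                  (trans (proj₂ (maxPos-spec σ σ-inj (subst (_< N) (sym pred-N) top<N))) pred-N)
    open Split σ-inj (at-into σ) (proj₂ (Equivalence.to Av-spec σ∈Av)) f-max
    a = build k before
    b = build r after
    a≗ = at-build k before before-into
    b≗ = at-build r after after-into
    a∈ : a ∈ Av k
    a∈ = Equivalence.from Av-spec (Inj-agree (Agree-sym a≗) before-inj , before-avoid ∘ Has132-agree (Agree-sym a≗))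
    b∈ : b ∈ Av r
    b∈ = Equivalence.from Av-spec (Inj-agree (Agree-sym b≗) after-inj , after-avoid ∘ Has132-agree (Agree-sym b≗))
    agree : Agree N (at (combine (a , b))) (at σ)
    agree i<N = trans (combine-agree a∈ b∈ i<N) (trans (join-agree k r a≗ b≗ i<N) (join-split i<N))

  maxClassPoly-join : ∀ j → maxClassPoly N k j ≡ shift k (avPoly k ⊗ avPoly r) j
  maxClassPoly-join j = begin
      count (λ σ → coinv σ ≡ᵇ j) maxAt
        ≡⟨ bijection-count (λ σ → coinv σ ≡ᵇ j) combine (cartesianProduct⁺ (Av-unique k) (Av-unique r))
             (filter⁺ _ (Av-unique N)) combine-into combine-onto combine-injective ⟨
      count (λ ab → coinv (combine ab) ≡ᵇ j) pairs
        ≡⟨ count-cong _ _ pairs (λ {ab} ab∈ → cong (_≡ᵇ j) (coinv-pair ab∈)) ⟩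
      count (λ ab → (k + (coinv (proj₁ ab) + coinv (proj₂ ab))) ≡ᵇ j) pairs
        ≡⟨ count-shift (λ ab → coinv (proj₁ ab) + coinv (proj₂ ab)) pairs k j ⟩
      (if j <ᵇ k then 0 else count (λ ab → (coinv (proj₁ ab) + coinv (proj₂ ab)) ≡ᵇ (j ∸ k)) pairs)
        ≡⟨ cong (if j <ᵇ k then 0 else_) (trans (count-convolution coinv coinv (Av k) (Av r) (j ∸ k))
                                                (sym (Σ<≡S (suc (j ∸ k)) _))) ⟩
      shift k (avPoly k ⊗ avPoly r) j ∎
    where
    open ≡-Reasoning
    coinv-pair : ∀ {ab} → ab ∈ pairs → coinv (combine ab) ≡ k + (coinv (proj₁ ab) + coinv (proj₂ ab))
    coinv-pair {a , b} ab∈ = combine-coinv (proj₁ (∈-cartesianProduct⁻ (Av k) (Av r) ab∈)) (proj₂ (∈-cartesianProduct⁻ (Av k) (Av r) ab∈))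

-- The recurrence A_{n+1} = Σ_{k ≤ n} q^k A_k A_{n-k}: classify by the position of the maximum.
avPoly-suc : ∀ n j → avPoly (suc n) j ≡ S (suc n) (λ k → shift k (avPoly k ⊗ avPoly (n ∸ k)) j)
avPoly-suc n j =
  trans (count-partition (λ σ → coinv σ ≡ᵇ j) maxPos (suc n) (Av (suc n))
          (λ {σ} σ∈ → proj₁ (maxPos-spec σ (proj₁ (Equivalence.to Av-spec σ∈)) ≤-refl)))
        (S-cong (suc n) _ _ (λ k k<1+n → trans (count-filter _ _ (Av (suc n))) (class k (s≤s⁻¹ k<1+n))))
  where
  class : ∀ k → k ≤ n → maxClassPoly (suc n) k j ≡ shift k (avPoly k ⊗ avPoly (n ∸ k)) j
  class k k≤n = trans (cong (λ N → maxClassPoly N k j) (sym N≡)) (Decomposition.maxClassPoly-join k (n ∸ k) j)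
    where
    N≡ : k + suc (n ∸ k) ≡ suc n
    N≡ = trans (+-suc k (n ∸ k)) (cong suc (m+[n∸m]≡n k≤n))

-- (C) Reverse-complement: FI_N(132) versus FI_N(213)

mirror : ℕ → ℕ → ℕ
mirror N i = N ∸ suc i

mirror-into : ∀ {N i} → i < N → mirror N i < N
mirror-into {suc n} {i} _ = s≤s (m∸n≤m n i)

mirror-mirror : ∀ {N i} → i < N → mirror N (mirror N i) ≡ i
mirror-mirror {suc n} (s≤s i≤n) = m∸[m∸n]≡n i≤n

mirror-inj : ∀ {N} → Inj N (mirror N)
mirror-inj {N} i<N j<N e = trans (sym (mirror-mirror i<N)) (trans (cong (mirror N) e) (mirror-mirror j<N))

mirror-anti : ∀ {N a b} → a < b → b < N → mirror N b < mirror N a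
mirror-anti {suc n} a<b (s≤s b≤n) = ∸-monoʳ-< a<b b≤n

mirror-reflect : ∀ {N a b} → mirror N a < mirror N b → b < a
mirror-reflect {suc n} d = ∸-cancelʳ-< d

mirror-<ᵇ : ∀ {N a b} → a < N → b < N → (mirror N a <ᵇ mirror N b) ≡ (b <ᵇ a)
mirror-<ᵇ {N} {a} {b} a<N b<N with b <? a
... | yes b<a = trans (<ᵇ-true (mirror-anti b<a a<N)) (sym (<ᵇ-true b<a))
... | no b≮a  = trans (<ᵇ-false {mirror N a} {mirror N b} (∸-monoʳ-≤ N (s≤s (≮⇒≥ b≮a)))) (sym (<ᵇ-false (≮⇒≥ b≮a)))

rc : ℕ → (ℕ → ℕ) → ℕ → ℕ
rc N f i = mirror N (f (mirror N i))

rc-agree : ∀ N {f g} → Agree N f g → Agree N (rc N f) (rc N g)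
rc-agree N f≗g i<N = cong (mirror N) (f≗g (mirror-into i<N))

module ReverseComplement {N : ℕ} {f : ℕ → ℕ} (into : Into N N f) where
  private
    g = rc N f

  rc-into : Into N N g
  rc-into i<N = mirror-into (into (mirror-into i<N))

  rc-rc : Agree N (rc N g) f
  rc-rc i<N = trans (mirror-mirror (into (mirror-into (mirror-into i<N)))) (cong f (mirror-mirror i<N))

  rc-inj : Inj N f → Inj N g
  rc-inj inj i<N j<N e = mirror-inj i<N j<N
    (inj (mirror-into i<N) (mirror-into j<N) (mirror-inj (into (mirror-into i<N)) (into (mirror-into j<N)) e))

  rc-invol : Invol N f → Invol N g
  rc-invol invol {i} i<N = trans (cong (λ z → mirror N (f z)) (mirror-mirror (into (mirror-into i<N))))
                                 (trans (cong (mirror N) (invol (mirror-into i<N))) (mirror-mirror i<N))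

  rc-fpf : FixedPointFree N f → FixedPointFree N g
  rc-fpf fpf {i} i<N e = fpf (mirror-into i<N)
    (trans (sym (mirror-mirror (into (mirror-into i<N)))) (cong (mirror N) e))

  -- Reading an occurrence backwards with complemented values turns 213 into 132
  -- and 132 into 213.
  rc-213→132 : Has213 N g → Has132 N f
  rc-213→132 (p , q , s , p<q , q<s , s<N , gq<gp , gp<gs) =
    mirror N s , mirror N q , mirror N p , mirror-anti q<s s<N , mirror-anti p<q (<-trans q<s s<N) ,
    mirror-into (<-trans p<q (<-trans q<s s<N)) , mirror-reflect {N} gp<gs , mirror-reflect {N} gq<gp

  rc-132→213 : Has132 N g → Has213 N f
  rc-132→213 (p , q , s , p<q , q<s , s<N , gp<gs , gs<gq) =
    mirror N s , mirror N q , mirror N p , mirror-anti q<s s<N , mirror-anti p<q (<-trans q<s s<N) ,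
    mirror-into (<-trans p<q (<-trans q<s s<N)) , mirror-reflect {N} gs<gq , mirror-reflect {N} gp<gs

  rc-isFI : ∀ {Has Has′} → (Has′ N g → Has N f) → IsFI Has N f → IsFI Has′ N g
  rc-isFI back ι = record
    { injective      = rc-inj (IsFI.injective ι)
    ; involutive     = rc-invol (IsFI.involutive ι)
    ; fixedPointFree = rc-fpf (IsFI.fixedPointFree ι)
    ; avoiding       = IsFI.avoiding ι ∘ back }

  -- Reindexing both sums by the mirror turns coinversions (i , j) of g into
  -- coinversions (N−1−j , N−1−i) of f.
  rc-coinv : coinvOn N g ≡ coinvOn N f
  rc-coinv = begin
      S N (λ i → S N (coinvPair g i))
        ≡⟨ S-reindex (mirror-inj {N}) mirror-into _ ⟩
      S N (λ x → S N (coinvPair g (mirror N x)))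
        ≡⟨ S-cong N _ _ (λ x _ → S-reindex (mirror-inj {N}) mirror-into _) ⟩
      S N (λ x → S N (λ y → coinvPair g (mirror N x) (mirror N y)))
        ≡⟨ S-cong N _ _ (λ x x<N → S-cong N _ _ (λ y y<N →
             cong₂ (λ u v → ind (u ∧ v)) (mirror-<ᵇ x<N y<N)
               (trans (cong₂ _<ᵇ_ (g-mirror x<N) (g-mirror y<N)) (mirror-<ᵇ (into x<N) (into y<N))))) ⟩
      S N (λ x → S N (λ y → coinvPair f y x))
        ≡⟨ S-swap N N (λ x y → coinvPair f y x) ⟩
      S N (λ y → S N (coinvPair f y)) ∎
    where
    open ≡-Reasoning
    g-mirror : ∀ {x} → x < N → g (mirror N x) ≡ mirror N (f x)
    g-mirror x<N = cong (λ z → mirror N (f z)) (mirror-mirror x<N)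

module ReverseComplementWord (N : ℕ) where

  rcWord : Vec (Fin N) N → Vec (Fin N) N
  rcWord σ = build N (rc N (at σ))

  rcWord-agree : (σ : Vec (Fin N) N) → Agree N (at (rcWord σ)) (rc N (at σ))
  rcWord-agree σ = at-build N _ (ReverseComplement.rc-into (at-into σ))

  rcWord-involutive : (σ : Vec (Fin N) N) → rcWord (rcWord σ) ≡ σ
  rcWord-involutive σ = at-injective (rcWord (rcWord σ)) σ (λ i<N →
    trans (rcWord-agree (rcWord σ) i<N)
      (trans (rc-agree N (rcWord-agree σ) i<N) (ReverseComplement.rc-rc (at-into σ) i<N)))

  rcWord-coinv : (σ : Vec (Fin N) N) → coinv (rcWord σ) ≡ coinv σ
  rcWord-coinv σ = begin
      coinv (rcWord σ)               ≡⟨ coinv-at (rcWord σ) ⟩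
      coinvOn N (at (rcWord σ))      ≡⟨ coinvOn-agree (rcWord-agree σ) ⟩
      coinvOn N (rc N (at σ))        ≡⟨ ReverseComplement.rc-coinv (at-into σ) ⟩
      coinvOn N (at σ)               ≡⟨ coinv-at σ ⟨
      coinv σ                        ∎
    where open ≡-Reasoning

  rcWord-132 : ∀ {σ} → σ ∈ FI N p132 → rcWord σ ∈ FI N p213
  rcWord-132 {σ} σ∈ = Equivalence.from FI213-spec (IsFI-agree (Agree-sym (rcWord-agree σ)) rc-into
      (Has213-agree (Agree-sym (rcWord-agree σ))) (rc-isFI rc-213→132 (Equivalence.to FI132-spec σ∈)))
    where open ReverseComplement (at-into σ)

  rcWord-213 : ∀ {σ} → σ ∈ FI N p213 → rcWord σ ∈ FI N p132
  rcWord-213 {σ} σ∈ = Equivalence.from FI132-spec (IsFI-agree (Agree-sym (rcWord-agree σ)) rc-into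
      (Has132-agree (Agree-sym (rcWord-agree σ))) (rc-isFI rc-132→213 (Equivalence.to FI213-spec σ∈)))
    where open ReverseComplement (at-into σ)

reverse-complement-count : (N j : ℕ) →
  count (λ σ → coinv σ ≡ᵇ j) (FI N p213) ≡ count (λ σ → coinv σ ≡ᵇ j) (FI N p132)
reverse-complement-count N j = begin
    count (λ σ → coinv σ ≡ᵇ j) (FI N p213)
      ≡⟨ bijection-count (λ σ → coinv σ ≡ᵇ j) rcWord (FI-unique N p132) (FI-unique N p213) rcWord-132
           (λ {τ} τ∈ → rcWord τ , rcWord-213 τ∈ , rcWord-involutive τ)
           (λ {σ} {σ′} _ _ e → trans (sym (rcWord-involutive σ)) (trans (cong rcWord e) (rcWord-involutive σ′))) ⟨
    count (λ σ → coinv (rcWord σ) ≡ᵇ j) (FI N p132)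
      ≡⟨ count-cong _ _ (FI N p132) (λ {σ} _ → cong (_≡ᵇ j) (rcWord-coinv σ)) ⟩
    count (λ σ → coinv σ ≡ᵇ j) (FI N p132) ∎
  where
  open ≡-Reasoning
  open ReverseComplementWord N

nth-++ˡ : (xs ys : List Poly) (k : ℕ) → k < length xs → nth (xs ++ ys) k ≡ nth xs k
nth-++ˡ (x ∷ xs) ys zero    _        = refl
nth-++ˡ (x ∷ xs) ys (suc k) (s≤s k<) = nth-++ˡ xs ys k k<

nth-last : (xs : List Poly) (y : Poly) → nth (xs ++ y ∷ []) (length xs) ≡ y
nth-last []       y = refl
nth-last (x ∷ xs) y = nth-last xs y

catUpTo-length : ∀ n → length (catUpTo n) ≡ suc n
catUpTo-length zero    = refl
catUpTo-length (suc n) = trans (length-++ (catUpTo n)) (trans (cong (_+ 1) (catUpTo-length n)) (+-comm (suc n) 1))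

catUpTo-nth : ∀ n k → k ≤ n → nth (catUpTo n) k ≡ C k
catUpTo-nth zero    zero _   = refl
catUpTo-nth (suc n) k k≤1+n with k ≤? n
... | yes k≤n = trans (nth-++ˡ (catUpTo n) _ k (subst (k <_) (sym (catUpTo-length n)) (s≤s k≤n)))
                      (catUpTo-nth n k k≤n)
... | no k≰n with ≤-antisym k≤1+n (≰⇒> k≰n)
...   | refl = refl

C-suc : ∀ n j → C (suc n) j ≡ S (suc n) (λ k → shift k (C k ⊗ C (n ∸ k)) j)
C-suc n j = trans (cong (λ F → F j) last) (trans (Σ<≡S (suc n) _)
    (S-cong (suc n) _ _ (λ k k<1+n → cong₂ (λ F G → shift k (F ⊗ G) j)
      (catUpTo-nth n k (s≤s⁻¹ k<1+n)) (catUpTo-nth n (n ∸ k) (m∸n≤m n k)))))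
  where
  last : C (suc n) ≡ catStep n (catUpTo n)
  last = subst (λ L → nth (catUpTo n ++ catStep n (catUpTo n) ∷ []) L ≡ catStep n (catUpTo n))
               (catUpTo-length n) (nth-last (catUpTo n) _)

catalan-unique : (A : ℕ → Poly) → (∀ j → A 0 j ≡ C 0 j) →
  (∀ n j → A (suc n) j ≡ S (suc n) (λ k → shift k (A k ⊗ A (n ∸ k)) j)) →
  ∀ n j → A n j ≡ C n j
catalan-unique A A0 Asuc n = below n n ≤-refl
  where
  step : ∀ {F F′ G G′ : Poly} k → (∀ i → F i ≡ F′ i) → (∀ i → G i ≡ G′ i) → ∀ j →
    shift k (F ⊗ G) j ≡ shift k (F′ ⊗ G′) j
  step {F} {F′} {G} {G′} k F≗F′ G≗G′ j with j <ᵇ k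
  ... | true  = refl
  ... | false = trans (Σ<≡S (suc (j ∸ k)) _) (trans (S-cong (suc (j ∸ k)) _ _ (λ i _ → cong₂ _*_ (F≗F′ i) (G≗G′ (j ∸ k ∸ i))))
                      (sym (Σ<≡S (suc (j ∸ k)) _)))
  below : ∀ n k → k ≤ n → ∀ j → A k j ≡ C k j
  below zero    zero _ j = A0 j
  below (suc n) k k≤1+n j with k ≤? n
  ... | yes k≤n = below n k k≤n j
  ... | no k≰n with ≤-antisym k≤1+n (≰⇒> k≰n)
  ...   | refl = trans (Asuc n j) (trans (S-cong (suc n) _ _ (λ k k<1+n →
            step k (below n k (s≤s⁻¹ k<1+n)) (below n (n ∸ k) (m∸n≤m n k)) j)) (sym (C-suc n j)))

avPoly≡C : ∀ n j → avPoly n j ≡ C n j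
avPoly≡C = catalan-unique avPoly initial avPoly-suc
  where
  initial : ∀ j → avPoly 0 j ≡ C 0 j
  initial zero    = refl
  initial (suc j) = refl

theorem3p9 : (m : ℕ) → (j : ℕ) →
    (coinvGF (FI (2 * m) p132) j ≡ substSq (C m) j)
      × (coinvGF (FI (2 * m) p213) j ≡ substSq (C m) j)
theorem3p9 m j = FI132-poly , FI213-poly
  where
  open ≡-Reasoning
  coefficient : ∀ {N} → List (Vec (Fin N) N) → ℕ
  coefficient S = count (λ σ → coinv σ ≡ᵇ j) S
  2m≡m+m : 2 * m ≡ m + m
  2m≡m+m = cong (m +_) (+-identityʳ m)

  FI132-poly : coinvGF (FI (2 * m) p132) j ≡ substSq (C m) j
  FI132-poly = begin
      coinvGF (FI (2 * m) p132) j    ≡⟨ length-filter _ (FI (2 * m) p132) ⟩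
      coefficient (FI (2 * m) p132)  ≡⟨ cong (λ N → coefficient (FI N p132)) 2m≡m+m ⟩
      coefficient (FI (m + m) p132)  ≡⟨ halving-count m j ⟩
      substSq (avPoly m) j           ≡⟨ cong (if j % 2 ≡ᵇ 0 then_else 0) (avPoly≡C m (j / 2)) ⟩
      substSq (C m) j                ∎

  FI213-poly : coinvGF (FI (2 * m) p213) j ≡ substSq (C m) j
  FI213-poly = begin
      coinvGF (FI (2 * m) p213) j    ≡⟨ length-filter _ (FI (2 * m) p213) ⟩
      coefficient (FI (2 * m) p213)  ≡⟨ reverse-complement-count (2 * m) j ⟩
      coefficient (FI (2 * m) p132)  ≡⟨ length-filter _ (FI (2 * m) p132) ⟨
      coinvGF (FI (2 * m) p132) j    ≡⟨ FI132-poly ⟩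
      substSq (C m) j                ∎
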